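{- Let $n>1$ be an integer and $U_{6n}=\langle a,b\mid a^{2n}=b^3=1,\ a^{ -1}ba=b^{ -1}\rangle$. Let $S=S_1\cup S_2$ with $S_1=\{a^{2r},a^{2r}b,a^{2r}b^2\mid 1\le r\le n-1\}$ and $S_2=\{a^{2h+1},a^{2h+1}b,a^{2h+1}b^2\mid 0\le h\le n-1\}$. Then $\mathrm{Cay}(U_{6n},S)$ is a connected integral graph whose spectrum is $\{[-3]^{2n-1},[0]^{4n},6n-3\}$.
   Context: Cayley graph $\mathrm{Cay}(G,S)$: vertex set $G$, edges $\{g,sg\}$ ($g\in G,s\in S$); integral means all adjacency eigenvalues are integers. In the spectrum, $[\lambda]^m$ denotes eigenvalue $\lambda$ with multiplicity $m$ (no exponent means multiplicity 1). -}

module Defs where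

open import Data.Nat as ℕ using (ℕ; zero; suc; NonZero; _%_)
open import Data.Nat.DivMod using (_mod_)
open import Data.Fin as Fin using (Fin; toℕ; punchIn; remQuot)
open import Data.Fin.Properties as FinP using ()
open import Data.Integer as ℤ using (ℤ; +_; _-_; _^_; -_)
open import Data.Product using (_×_; _,_; ∃; Σ)
open import Data.Product.Properties using (≡-dec)
open import Data.List using (List; []; _∷_; _++_; map; concatMap; upTo; length)
open import Data.List.Membership.Propositional using (_∈_)
open import Data.List.Relation.Unary.Any using (any?)
open import Data.Bool using (if_then_else_)
open import Relation.Nullary using (does)
open import Relation.Binary.PropositionalEquality using (_≡_)

-- The group U_{6n} = ⟨a,b | a^{2n} = b^3 = 1, a⁻¹ b a = b⁻¹⟩, realised
-- concretely by its normal forms a^i b^j (i mod 2n, j mod 3).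
-- From a⁻¹ b a = b⁻¹ we get b^j a^k = a^k b^{j(-1)^k}, hence
--   (a^i b^j)(a^k b^l) = a^{i+k} b^{j(-1)^k + l}.

2*-nonZero : ∀ n → .{{NonZero n}} → NonZero (2 ℕ.* n)
2*-nonZero (suc n) = _

module _ (n : ℕ) .{{_ : NonZero n}} where

  U : Set
  U = Fin (2 ℕ.* n) × Fin 3

  ab : ℕ → ℕ → U
  ab i j = ((i mod (2 ℕ.* n)) {{2*-nonZero n}}) , (j mod 3)

  -- j(-1)^k  (mod 3), using -1 ≡ 2 (mod 3)
  twist : ℕ → ℕ → ℕ
  twist k j = if does (k % 2 ℕ.≟ 0) then j else 2 ℕ.* j

  infixl 7 _·_
  _·_ : U → U → U
  (i , j) · (k , l) =
    ab (toℕ i ℕ.+ toℕ k) (twist (toℕ k) (toℕ j) ℕ.+ toℕ l)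

  S₁ : List U
  S₁ = concatMap (λ r → map (λ j → ab (2 ℕ.* r) j) (upTo 3))
                 (map suc (upTo (n ℕ.∸ 1)))

  S₂ : List U
  S₂ = concatMap (λ h → map (λ j → ab (suc (2 ℕ.* h)) j) (upTo 3))
                 (upTo n)

  S : List U
  S = S₁ ++ S₂

module Cayley {G : Set} (_≟_ : (x y : G) → Relation.Nullary.Dec (x ≡ y))
              (_∙_ : G → G → G) (Sl : List G) where

  Adj : G → G → Set
  Adj g h = ∃ λ s → s ∈ Sl × h ≡ s ∙ g

  adj : G → G → ℤ
  adj g h = if does (any? (λ s → h ≟ (s ∙ g)) Sl) then + 1 else + 0

  data Walk (g : G) : G → Set where
    here : Walk g g
    step : ∀ {h k} → Walk g h → Adj h k → Walk g k

  Connected : Set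
  Connected = ∀ g h → Walk g h

Σℤ : ∀ {m} → (Fin m → ℤ) → ℤ
Σℤ {zero}  f = + 0
Σℤ {suc m} f = f Fin.zero ℤ.+ Σℤ (λ i → f (Fin.suc i))

det : ∀ m → (Fin m → Fin m → ℤ) → ℤ
det zero    M = + 1
det (suc m) M =
  Σℤ (λ j → ((- + 1) ^ toℕ j) ℤ.* M Fin.zero j
              ℤ.* det m (λ r c → M (Fin.suc r) (punchIn j c)))

charPoly : ∀ m → (Fin m → Fin m → ℤ) → ℤ → ℤ
charPoly m A x =
  det m (λ i j → (if does (i FinP.≟ j) then x else + 0) - A i j)

prodSpec : List (ℤ × ℕ) → ℤ → ℤ
prodSpec []              x = + 1
prodSpec ((λ₀ , k) ∷ sp) x = ((x - λ₀) ^ k) ℤ.* prodSpec sp x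

-- A has spectrum sp: det(xI - A) = ∏ (x - λ)^{m_λ} as polynomials
-- (equivalently, for all integers x, since both sides have degree m).
HasSpectrum : ∀ m → (Fin m → Fin m → ℤ) → List (ℤ × ℕ) → Set
HasSpectrum m A sp = ∀ x → charPoly m A x ≡ prodSpec sp x

-- integral: all eigenvalues (roots of the char. polynomial, with
-- multiplicity) are integers
Integral : ∀ m → (Fin m → Fin m → ℤ) → Set
Integral m A = Σ (List (ℤ × ℕ)) λ sp → HasSpectrum m A sp

-- The Cayley graph Cay(U_{6n}, S), with vertices indexed by Fin (6n)
-- via the bijection Fin ((2n)·3) ≅ Fin (2n) × Fin 3.

module _ (n : ℕ) .{{_ : NonZero n}} where

  private
    module C = Cayley (≡-dec FinP._≟_ FinP._≟_) (_·_ n) (S n)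

  CayConnected : Set
  CayConnected = C.Connected

  A : Fin ((2 ℕ.* n) ℕ.* 3) → Fin ((2 ℕ.* n) ℕ.* 3) → ℤ
  A i j = C.adj (remQuot 3 i) (remQuot 3 j)

module Submission where

-- The connection set S consists exactly of the elements a^t b^j with t ≢ 0 (mod 2n), so g ∼ h
-- iff g and h lie in different cosets of ⟨b⟩: Cay(U_{6n}, S) is the complete multipartite graph
-- with 2n parts of size 3, any two vertices are joined by a path of length at most 2, and
-- A = J − I_{2n} ⊗ J_3. The characteristic polynomial det(xI − A) is computed by row operations:
-- collecting the sum of all rows in one row extracts the factor x − 3(2n − 1) and leaves a row of
-- ones; adding it to the other rows makes them block diagonal with blocks xI + J_3; subtracting
-- first rows within each block and then clearing the first rows leaves a triangular matrix.
-- Altogether det(xI − A) = (x − 3(2n − 1)) x^{4n} (x + 3)^{2n − 1}.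

open import Defs
open import Data.Bool using (Bool; true; false; if_then_else_; not; _∧_)
open import Data.Empty using (⊥-elim)
open import Data.Fin as Fin using (Fin; toℕ; punchIn; punchOut; combine; remQuot; _↑ˡ_; _↑ʳ_)
  renaming (zero to fzero; suc to fsuc)
open import Data.Fin.Patterns using (0F; 1F; 2F)
import Data.Fin.Properties as Finₚ
open import Data.Integer as ℤ using (ℤ; +_; -_; _+_; _*_; _-_; _^_)
import Data.Integer.Properties as ℤₚ
open import Data.Integer.Tactic.RingSolver using (solve-∀)
open import Data.List using (List; []; _∷_; map; upTo)
open import Data.List.Membership.Propositional using (_∈_; find; lose)
open import Data.List.Membership.Propositional.Properties
  using (∈-map⁺; ∈-map⁻; ∈-++⁺ˡ; ∈-++⁺ʳ; ∈-++⁻; ∈-concatMap⁺; ∈-concatMap⁻; ∈-upTo⁺; ∈-upTo⁻)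
open import Data.List.Relation.Unary.Any using (any?)
open import Data.Nat as ℕ using (ℕ; zero; suc; NonZero; _%_; _/_)
open import Data.Nat.DivMod
  using (_mod_; m%n<n; m<n⇒m%n≡m; m≤n⇒[n∸m]%m≡n%m; %-distribˡ-+; m%n%n≡m%n; [m+n]%n≡m%n; m≡m%n+[m/n]*n)
import Data.Nat.Properties as ℕₚ
import Data.Nat.Tactic.RingSolver as ℕ-Solver
open import Data.Product using (_×_; _,_; proj₁; proj₂; ∃)
open import Data.Product.Properties using (≡-dec)
open import Data.Sum using (inj₁; inj₂)
open import Data.Vec.Functional using (updateAt)
open import Data.Vec.Functional.Properties using (updateAt-updates; updateAt-minimal)
open import Function using (_∘_)
open import Relation.Binary.PropositionalEquality
open import Relation.Nullary using (¬_; yes; no; does)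
open import Relation.Nullary.Decidable using (dec-true; dec-false)

open ≡-Reasoning

-- Finite sums and products over Fin

Σℤ-cong : ∀ {m} {f g : Fin m → ℤ} → (∀ i → f i ≡ g i) → Σℤ f ≡ Σℤ g
Σℤ-cong {zero}  f≗g = refl
Σℤ-cong {suc m} f≗g = cong₂ _+_ (f≗g fzero) (Σℤ-cong (f≗g ∘ fsuc))

Σℤ-zeros : ∀ {m} {f : Fin m → ℤ} → (∀ i → f i ≡ + 0) → Σℤ f ≡ + 0
Σℤ-zeros {zero}  f≗0 = refl
Σℤ-zeros {suc m} f≗0 = cong₂ _+_ (f≗0 fzero) (Σℤ-zeros (f≗0 ∘ fsuc))

Σℤ-distrib-+ : ∀ {m} (f g : Fin m → ℤ) → Σℤ (λ i → f i + g i) ≡ Σℤ f + Σℤ g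
Σℤ-distrib-+ {zero}  f g = refl
Σℤ-distrib-+ {suc m} f g =
  trans (cong (_+_ (f fzero + g fzero)) (Σℤ-distrib-+ (f ∘ fsuc) (g ∘ fsuc)))
        (interchange (f fzero) (g fzero) _ _)
  where
  interchange : ∀ a b c d → a + b + (c + d) ≡ a + c + (b + d)
  interchange = solve-∀

*-distribˡ-Σℤ : ∀ {m} (a : ℤ) (f : Fin m → ℤ) → a * Σℤ f ≡ Σℤ (λ i → a * f i)
*-distribˡ-Σℤ {zero}  a f = ℤₚ.*-zeroʳ a
*-distribˡ-Σℤ {suc m} a f =
  trans (ℤₚ.*-distribˡ-+ a (f fzero) _) (cong (_+_ (a * f fzero)) (*-distribˡ-Σℤ a (f ∘ fsuc)))

neg-distrib-Σℤ : ∀ {m} (f : Fin m → ℤ) → - Σℤ f ≡ Σℤ (λ i → - f i)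
neg-distrib-Σℤ {zero}  f = refl
neg-distrib-Σℤ {suc m} f =
  trans (ℤₚ.neg-distrib-+ (f fzero) _) (cong (_+_ (- f fzero)) (neg-distrib-Σℤ (f ∘ fsuc)))

Σℤ-linear : ∀ {m} (a b : ℤ) (f g : Fin m → ℤ) →
            Σℤ (λ i → a * f i + b * g i) ≡ a * Σℤ f + b * Σℤ g
Σℤ-linear a b f g =
  trans (Σℤ-distrib-+ (λ i → a * f i) (λ i → b * g i)) (sym (cong₂ _+_ (*-distribˡ-Σℤ a f) (*-distribˡ-Σℤ b g)))

Σℤ-comm : ∀ {m p} (f : Fin m → Fin p → ℤ) →
          Σℤ (λ i → Σℤ (f i)) ≡ Σℤ (λ j → Σℤ (λ i → f i j))
Σℤ-comm {zero} {p} f = sym (Σℤ-zeros {p} (λ _ → refl))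
Σℤ-comm {suc m} f =
  trans (cong (_+_ (Σℤ (f fzero))) (Σℤ-comm (f ∘ fsuc)))
        (sym (Σℤ-distrib-+ (f fzero) (λ j → Σℤ (λ i → f (fsuc i) j))))

Σℤ-punchIn : ∀ {m} (f : Fin (suc m) → ℤ) j → f j ≡ + 0 → Σℤ (f ∘ punchIn j) ≡ Σℤ f
Σℤ-punchIn f fzero f0≡0 = sym (trans (cong (_+ Σℤ (f ∘ fsuc)) f0≡0) (ℤₚ.+-identityˡ _))
Σℤ-punchIn {suc m} f (fsuc j) fj≡0 = cong (_+_ (f fzero)) (Σℤ-punchIn (f ∘ fsuc) j fj≡0)

Σℤ-const : ∀ m (c : ℤ) → Σℤ {m} (λ _ → c) ≡ + m * c
Σℤ-const zero    c = sym (ℤₚ.*-zeroˡ c)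
Σℤ-const (suc m) c = trans (cong (_+_ c) (Σℤ-const m c)) (sym (ℤₚ.suc-* (+ m) c))

Σℤ-↑ : ∀ p q (f : Fin (p ℕ.+ q) → ℤ) → Σℤ f ≡ Σℤ (λ i → f (i ↑ˡ q)) + Σℤ (λ i → f (p ↑ʳ i))
Σℤ-↑ zero    q f = sym (ℤₚ.+-identityˡ _)
Σℤ-↑ (suc p) q f =
  trans (cong (_+_ (f fzero)) (Σℤ-↑ p q (f ∘ fsuc))) (sym (ℤₚ.+-assoc (f fzero) _ _))

Σℤ-combine : ∀ b k (f : Fin (b ℕ.* k) → ℤ) → Σℤ f ≡ Σℤ {b} (λ q → Σℤ {k} (λ r → f (combine q r)))
Σℤ-combine zero    k f = refl
Σℤ-combine (suc b) k f =
  trans (Σℤ-↑ k (b ℕ.* k) f) (cong (_+_ (Σℤ (λ r → f (r ↑ˡ (b ℕ.* k))))) (Σℤ-combine b k (f ∘ (k ↑ʳ_))))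

Πℤ : ∀ {m} → (Fin m → ℤ) → ℤ
Πℤ {zero}  f = + 1
Πℤ {suc m} f = f fzero * Πℤ (f ∘ fsuc)

Πℤ-cong : ∀ {m} {f g : Fin m → ℤ} → (∀ i → f i ≡ g i) → Πℤ f ≡ Πℤ g
Πℤ-cong {zero}  f≗g = refl
Πℤ-cong {suc m} f≗g = cong₂ _*_ (f≗g fzero) (Πℤ-cong (f≗g ∘ fsuc))

Πℤ-↑ : ∀ p q (f : Fin (p ℕ.+ q) → ℤ) → Πℤ f ≡ Πℤ (λ i → f (i ↑ˡ q)) * Πℤ (λ i → f (p ↑ʳ i))
Πℤ-↑ zero    q f = sym (ℤₚ.*-identityˡ _)
Πℤ-↑ (suc p) q f =
  trans (cong (f fzero *_) (Πℤ-↑ p q (f ∘ fsuc))) (sym (ℤₚ.*-assoc (f fzero) _ _))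

Πℤ-combine : ∀ b k (f : Fin (b ℕ.* k) → ℤ) → Πℤ f ≡ Πℤ {b} (λ q → Πℤ {k} (λ r → f (combine q r)))
Πℤ-combine zero    k f = refl
Πℤ-combine (suc b) k f =
  trans (Πℤ-↑ k (b ℕ.* k) f) (cong (Πℤ (λ r → f (r ↑ˡ (b ℕ.* k))) *_) (Πℤ-combine b k (f ∘ (k ↑ʳ_))))

Πℤ-single : ∀ {m} (t : Fin m) (v : ℤ) → Πℤ (λ j → if does (j Finₚ.≟ t) then v else + 1) ≡ v
Πℤ-single {suc m} fzero v = trans (cong (v *_) (Πℤ-ones m)) (ℤₚ.*-identityʳ v)
  where
  Πℤ-ones : ∀ k → Πℤ {k} (λ j → if does (fsuc j Finₚ.≟ fzero) then v else + 1) ≡ + 1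
  Πℤ-ones zero    = refl
  Πℤ-ones (suc k) = trans (ℤₚ.*-identityˡ _) (Πℤ-ones k)
Πℤ-single {suc m} (fsuc t) v = trans (ℤₚ.*-identityˡ _) (Πℤ-single t v)

Πℤ-last : ∀ b (u v : ℤ) → Πℤ {suc b} (λ q → if does (q Finₚ.≟ Fin.fromℕ b) then u else v) ≡ v ^ b * u
Πℤ-last zero    u v = trans (ℤₚ.*-identityʳ u) (sym (ℤₚ.*-identityˡ u))
Πℤ-last (suc b) u v = trans (cong (v *_) (Πℤ-last b u v)) (sym (ℤₚ.*-assoc v (v ^ b) u))

δ : ∀ {k} → Fin k → Fin k → ℤ
δ a b = if does (a Finₚ.≟ b) then + 1 else + 0

δ-refl : ∀ {k} (a : Fin k) → δ a a ≡ + 1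
δ-refl a with a Finₚ.≟ a
... | yes _  = refl
... | no a≢a = ⊥-elim (a≢a refl)

δ-≢ : ∀ {k} {a b : Fin k} → a ≢ b → δ a b ≡ + 0
δ-≢ {a = a} {b} a≢b with a Finₚ.≟ b
... | yes a≡b = ⊥-elim (a≢b a≡b)
... | no _    = refl

Σℤ-δ : ∀ {k} (a : ℤ) (t : Fin k) (f : Fin k → ℤ) → Σℤ (λ j → (a * δ j t) * f j) ≡ a * f t
Σℤ-δ {suc k} a fzero f = begin
  Σℤ (λ j → (a * δ j fzero) * f j)
    ≡⟨ cong₂ (λ d s → (a * d) * f fzero + s) (δ-refl {suc k} fzero) (Σℤ-zeros (λ j → zero-term a (f (fsuc j)))) ⟩
  (a * + 1) * f fzero + + 0
    ≡⟨ unit a (f fzero) ⟩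
  a * f fzero ∎
  where
  zero-term : ∀ a y → (a * + 0) * y ≡ + 0
  zero-term = solve-∀
  unit : ∀ a y → (a * + 1) * y + + 0 ≡ a * y
  unit = solve-∀
Σℤ-δ {suc k} a (fsuc t) f =
  trans (cong (_+_ ((a * + 0) * f fzero)) (Σℤ-δ a t (f ∘ fsuc))) (drop-zero a (f fzero) _)
  where
  drop-zero : ∀ a y z → (a * + 0) * y + z ≡ z
  drop-zero = solve-∀

Σℤ-δ′ : ∀ {k} (a : ℤ) (t : Fin k) → Σℤ (λ j → a * δ j t) ≡ a
Σℤ-δ′ a t = begin
  Σℤ (λ j → a * δ j t)              ≡⟨ Σℤ-cong (λ j → sym (ℤₚ.*-identityʳ (a * δ j t))) ⟩
  Σℤ (λ j → (a * δ j t) * + 1)      ≡⟨ Σℤ-δ a t (λ _ → + 1) ⟩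
  a * + 1                            ≡⟨ ℤₚ.*-identityʳ a ⟩
  a                                  ∎

Σℤ-except : ∀ {k} (a : ℤ) (t : Fin k) (f : Fin k → ℤ) → Σℤ (λ j → (a * (+ 1 - δ j t)) * f j) ≡ a * (Σℤ f - f t)
Σℤ-except a t f = begin
  Σℤ (λ j → (a * (+ 1 - δ j t)) * f j)              ≡⟨ Σℤ-cong (λ j → split a (δ j t) (f j)) ⟩
  Σℤ (λ j → a * f j + ((- a) * δ j t) * f j)         ≡⟨ Σℤ-distrib-+ (λ j → a * f j) (λ j → ((- a) * δ j t) * f j) ⟩
  Σℤ (λ j → a * f j) + Σℤ (λ j → ((- a) * δ j t) * f j) ≡⟨ cong₂ _+_ (sym (*-distribˡ-Σℤ a f)) (Σℤ-δ (- a) t f) ⟩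
  a * Σℤ f + (- a) * f t                             ≡⟨ merge a (Σℤ f) (f t) ⟩
  a * (Σℤ f - f t)                                   ∎
  where
  split : ∀ a d y → (a * (+ 1 - d)) * y ≡ a * y + ((- a) * d) * y
  split = solve-∀
  merge : ∀ a s y → a * s + (- a) * y ≡ a * (s - y)
  merge = solve-∀

Σℤ-δ₂ : ∀ {k} (a a′ : ℤ) (s t : Fin k) (f : Fin k → ℤ) →
        Σℤ (λ j → (a * δ j s + a′ * δ j t) * f j) ≡ a * f s + a′ * f t
Σℤ-δ₂ a a′ s t f = begin
  Σℤ (λ j → (a * δ j s + a′ * δ j t) * f j)
    ≡⟨ Σℤ-cong (λ j → ℤₚ.*-distribʳ-+ (f j) (a * δ j s) (a′ * δ j t)) ⟩
  Σℤ (λ j → (a * δ j s) * f j + (a′ * δ j t) * f j)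
    ≡⟨ Σℤ-distrib-+ (λ j → (a * δ j s) * f j) (λ j → (a′ * δ j t) * f j) ⟩
  Σℤ (λ j → (a * δ j s) * f j) + Σℤ (λ j → (a′ * δ j t) * f j)
    ≡⟨ cong₂ _+_ (Σℤ-δ a s f) (Σℤ-δ a′ t f) ⟩
  a * f s + a′ * f t ∎

-- Determinants via Laplace expansion along the first row

Matrix : ℕ → Set
Matrix m = Fin m → Fin m → ℤ

sign : ∀ {m} → Fin m → ℤ
sign j = (- + 1) ^ toℕ j

minor : ∀ {m} → Matrix (suc m) → Fin (suc m) → Matrix m
minor M j r c = M (fsuc r) (punchIn j c)

expansionTerm : ∀ {m} → Matrix (suc m) → Fin (suc m) → ℤ
expansionTerm {m} M j = sign j * M fzero j * det m (minor M j)

det-cong : ∀ m {M N : Matrix m} → (∀ i j → M i j ≡ N i j) → det m M ≡ det m N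
det-cong zero    M≗N = refl
det-cong (suc m) M≗N = Σℤ-cong λ j →
  cong₂ (λ a d → sign j * a * d) (M≗N fzero j) (det-cong m λ r c → M≗N (fsuc r) (punchIn j c))

det-linearAt : ∀ m (M₁ M₂ M : Matrix m) (t : Fin m) (a b : ℤ) →
  (∀ i → i ≢ t → ∀ c → M i c ≡ M₁ i c) → (∀ i → i ≢ t → ∀ c → M i c ≡ M₂ i c) →
  (∀ c → M t c ≡ a * M₁ t c + b * M₂ t c) → det m M ≡ a * det m M₁ + b * det m M₂
det-linearAt (suc m) M₁ M₂ M fzero a b M≗M₁ M≗M₂ Mt = begin
  Σℤ (expansionTerm M)
    ≡⟨ Σℤ-cong (λ j → cong₂ (λ e d → sign j * e * d) (Mt j) (minor≡ M₁ M≗M₁ j)) ⟩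
  Σℤ (λ j → sign j * (a * M₁ fzero j + b * M₂ fzero j) * det m (minor M₁ j))
    ≡⟨ Σℤ-cong (λ j → trans (expand a b (sign j) (M₁ fzero j) (M₂ fzero j) (det m (minor M₁ j)))
                            (cong (λ d → a * expansionTerm M₁ j + b * (sign j * M₂ fzero j * d)) (minors≡ j))) ⟩
  Σℤ (λ j → a * expansionTerm M₁ j + b * expansionTerm M₂ j)
    ≡⟨ Σℤ-linear a b (expansionTerm M₁) (expansionTerm M₂) ⟩
  a * det (suc m) M₁ + b * det (suc m) M₂ ∎
  where
  minor≡ : ∀ N → (∀ i → i ≢ fzero → ∀ c → M i c ≡ N i c) → ∀ j → det m (minor M j) ≡ det m (minor N j)
  minor≡ N M≗N j = det-cong m λ r c → M≗N (fsuc r) (λ ()) (punchIn j c)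
  minors≡ : ∀ j → det m (minor M₁ j) ≡ det m (minor M₂ j)
  minors≡ j = trans (sym (minor≡ M₁ M≗M₁ j)) (minor≡ M₂ M≗M₂ j)
  expand : ∀ a b s x y d → s * (a * x + b * y) * d ≡ a * (s * x * d) + b * (s * y * d)
  expand = solve-∀
det-linearAt (suc m) M₁ M₂ M (fsuc t) a b M≗M₁ M≗M₂ Mt = begin
  Σℤ (expansionTerm M)
    ≡⟨ Σℤ-cong (λ j → cong (sign j * M fzero j *_) (det-linearAt m _ _ _ t a b
         (λ i i≢t c → M≗M₁ (fsuc i) (i≢t ∘ Finₚ.suc-injective) (punchIn j c))
         (λ i i≢t c → M≗M₂ (fsuc i) (i≢t ∘ Finₚ.suc-injective) (punchIn j c))
         (λ c → Mt (punchIn j c)))) ⟩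
  Σℤ (λ j → sign j * M fzero j * (a * det m (minor M₁ j) + b * det m (minor M₂ j)))
    ≡⟨ Σℤ-cong (λ j → trans (expand a b (sign j) (M fzero j) (det m (minor M₁ j)) (det m (minor M₂ j)))
         (cong₂ (λ x y → a * (sign j * x * det m (minor M₁ j)) + b * (sign j * y * det m (minor M₂ j)))
                (M≗M₁ fzero (λ ()) j) (M≗M₂ fzero (λ ()) j))) ⟩
  Σℤ (λ j → a * expansionTerm M₁ j + b * expansionTerm M₂ j)
    ≡⟨ Σℤ-linear a b (expansionTerm M₁) (expansionTerm M₂) ⟩
  a * det (suc m) M₁ + b * det (suc m) M₂ ∎
  where
  expand : ∀ a b s x d₁ d₂ → s * x * (a * d₁ + b * d₂) ≡ a * (s * x * d₁) + b * (s * x * d₂)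
  expand = solve-∀

det-scaleRows : ∀ m (d : Fin m → ℤ) (M N : Matrix m) → (∀ i c → N i c ≡ d i * M i c) →
                det m N ≡ Πℤ d * det m M
det-scaleRows zero    d M N N≗dM = refl
det-scaleRows (suc m) d M N N≗dM = begin
  Σℤ (expansionTerm N)
    ≡⟨ Σℤ-cong (λ j → cong₂ (λ x y → sign j * x * y) (N≗dM fzero j)
                             (det-scaleRows m (d ∘ fsuc) (minor M j) (minor N j) (λ r c → N≗dM (fsuc r) (punchIn j c)))) ⟩
  Σℤ (λ j → sign j * (d fzero * M fzero j) * (Πℤ (d ∘ fsuc) * det m (minor M j)))
    ≡⟨ Σℤ-cong (λ j → regroup (sign j) (d fzero) (M fzero j) (Πℤ (d ∘ fsuc)) (det m (minor M j))) ⟩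
  Σℤ (λ j → Πℤ d * expansionTerm M j)
    ≡⟨ *-distribˡ-Σℤ (Πℤ d) (expansionTerm M) ⟨
  Πℤ d * det (suc m) M ∎
  where
  regroup : ∀ s a x p y → s * (a * x) * (p * y) ≡ (a * p) * (s * x * y)
  regroup = solve-∀

det-lowerTriangular : ∀ m (L : Matrix m) → (∀ i j → toℕ i ℕ.< toℕ j → L i j ≡ + 0) →
                      det m L ≡ Πℤ (λ i → L i i)
det-lowerTriangular zero    L upper≡0 = refl
det-lowerTriangular (suc m) L upper≡0 = begin
  + 1 * L fzero fzero * det m (minor L fzero) + Σℤ (expansionTerm L ∘ fsuc)
    ≡⟨ cong₂ (λ d s → + 1 * L fzero fzero * d + s)
         (det-lowerTriangular m (minor L fzero) (λ i j i<j → upper≡0 (fsuc i) (fsuc j) (ℕ.s≤s i<j)))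
         (Σℤ-zeros (λ j → trans (cong (λ x → sign (fsuc j) * x * det m (minor L (fsuc j)))
                                      (upper≡0 fzero (fsuc j) (ℕ.s≤s ℕ.z≤n)))
                                (vanish (sign (fsuc j)) (det m (minor L (fsuc j)))))) ⟩
  + 1 * L fzero fzero * Πℤ (λ i → L (fsuc i) (fsuc i)) + + 0
    ≡⟨ tidy (L fzero fzero) (Πℤ (λ i → L (fsuc i) (fsuc i))) ⟩
  Πℤ (λ i → L i i) ∎
  where
  vanish : ∀ s y → s * + 0 * y ≡ + 0
  vanish = solve-∀
  tidy : ∀ x y → + 1 * x * y + + 0 ≡ x * y
  tidy = solve-∀

sign-punchOut-antisym : ∀ {n} {j c : Fin (suc n)} (j≢c : j ≢ c) (c≢j : c ≢ j) →
                        sign j * sign (punchOut j≢c) ≡ - (sign c * sign (punchOut c≢j))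
sign-punchOut-antisym {n}     {fzero}  {fzero}  j≢c c≢j = ⊥-elim (j≢c refl)
sign-punchOut-antisym {suc n} {fzero}  {fsuc c} j≢c c≢j = flip (sign c)
  where
  flip : ∀ s → + 1 * s ≡ - ((- + 1 * s) * + 1)
  flip = solve-∀
sign-punchOut-antisym {suc n} {fsuc j} {fzero}  j≢c c≢j = flip (sign j)
  where
  flip : ∀ s → (- + 1 * s) * + 1 ≡ - (+ 1 * s)
  flip = solve-∀
sign-punchOut-antisym {suc n} {fsuc j} {fsuc c} j≢c c≢j =
  trans (both-negated (sign j) _) (trans (sign-punchOut-antisym (j≢c ∘ cong fsuc) (c≢j ∘ cong fsuc))
                                         (sym (cong -_ (both-negated (sign c) _))))
  where
  both-negated : ∀ a b → (- + 1 * a) * (- + 1 * b) ≡ a * b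
  both-negated = solve-∀

punchIn-punchOut-comm : ∀ {n} {j c : Fin (suc (suc n))} (j≢c : j ≢ c) (c≢j : c ≢ j) (x : Fin n) →
                        punchIn j (punchIn (punchOut j≢c) x) ≡ punchIn c (punchIn (punchOut c≢j) x)
punchIn-punchOut-comm {n}     {fzero}  {fzero}  j≢c c≢j x = ⊥-elim (j≢c refl)
punchIn-punchOut-comm {n}     {fzero}  {fsuc c} j≢c c≢j x = refl
punchIn-punchOut-comm {n}     {fsuc j} {fzero}  j≢c c≢j x = refl
punchIn-punchOut-comm {suc n} {fsuc j} {fsuc c} j≢c c≢j fzero    = refl
punchIn-punchOut-comm {suc n} {fsuc j} {fsuc c} j≢c c≢j (fsuc x) =
  cong fsuc (punchIn-punchOut-comm (j≢c ∘ cong fsuc) (c≢j ∘ cong fsuc) x)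

-- Laplace expansion along two rows u, v on top of the rows R: the coefficient of u j * v c
-- is antisymmetric in (j, c), so exchanging u and v negates the expansion.
module TwoRowExpansion (k : ℕ) (R : Fin k → Fin (suc (suc k)) → ℤ) where

  coefficient : Fin (suc (suc k)) → Fin (suc (suc k)) → ℤ
  coefficient j c with j Finₚ.≟ c
  ... | yes _   = + 0
  ... | no j≢c = sign j * sign (punchOut j≢c) * det k (λ r x → R r (punchIn j (punchIn (punchOut j≢c) x)))

  coefficient-diag : ∀ j → coefficient j j ≡ + 0
  coefficient-diag j with j Finₚ.≟ j
  ... | yes _   = refl
  ... | no j≢j = ⊥-elim (j≢j refl)

  coefficient-punchIn : ∀ j l → coefficient j (punchIn j l) ≡
                        sign j * sign l * det k (λ r x → R r (punchIn j (punchIn l x)))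
  coefficient-punchIn j l with j Finₚ.≟ punchIn j l
  ... | yes j≡ = ⊥-elim (Finₚ.punchInᵢ≢i j l (sym j≡))
  ... | no j≢ = cong (λ l′ → sign j * sign l′ * det k (λ r x → R r (punchIn j (punchIn l′ x))))
                     (trans (Finₚ.punchOut-cong j refl) (Finₚ.punchOut-punchIn j))

  coefficient-antisym : ∀ j c → coefficient j c ≡ - coefficient c j
  coefficient-antisym j c with j Finₚ.≟ c | c Finₚ.≟ j
  ... | yes _   | yes _   = refl
  ... | yes j≡c | no c≢j = ⊥-elim (c≢j (sym j≡c))
  ... | no j≢c | yes c≡j = ⊥-elim (j≢c (sym c≡j))
  ... | no j≢c | no c≢j = begin
    sign j * sign (punchOut j≢c) * det k (λ r x → R r (punchIn j (punchIn (punchOut j≢c) x)))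
      ≡⟨ cong (sign j * sign (punchOut j≢c) *_) (det-cong k (λ r x → cong (R r) (punchIn-punchOut-comm j≢c c≢j x))) ⟩
    sign j * sign (punchOut j≢c) * D
      ≡⟨ cong (_* D) (sign-punchOut-antisym j≢c c≢j) ⟩
    - (sign c * sign (punchOut c≢j)) * D
      ≡⟨ ℤₚ.neg-distribˡ-* (sign c * sign (punchOut c≢j)) D ⟨
    - (sign c * sign (punchOut c≢j) * D) ∎
    where
    D = det k (λ r x → R r (punchIn c (punchIn (punchOut c≢j) x)))

  expansion : (u v : Fin (suc (suc k)) → ℤ) → ℤ
  expansion u v = Σℤ (λ j → sign j * u j *
    Σℤ (λ l → sign l * v (punchIn j l) * det k (λ r c → R r (punchIn j (punchIn l c)))))

  expansion-double-sum : ∀ u v → expansion u v ≡ Σℤ (λ j → Σℤ (λ c → coefficient j c * u j * v c))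
  expansion-double-sum u v = Σℤ-cong λ j → begin
    sign j * u j * Σℤ (λ l → sign l * v (punchIn j l) * minor₂ j l)
      ≡⟨ *-distribˡ-Σℤ (sign j * u j) (λ l → sign l * v (punchIn j l) * minor₂ j l) ⟩
    Σℤ (λ l → sign j * u j * (sign l * v (punchIn j l) * minor₂ j l))
      ≡⟨ Σℤ-cong (λ l → trans (regroup (sign j) (u j) (sign l) (v (punchIn j l)) (minor₂ j l))
                              (cong (λ e → e * u j * v (punchIn j l)) (sym (coefficient-punchIn j l)))) ⟩
    Σℤ (λ l → coefficient j (punchIn j l) * u j * v (punchIn j l))
      ≡⟨ Σℤ-punchIn (λ c → coefficient j c * u j * v c) j
                    (trans (cong (λ e → e * u j * v j) (coefficient-diag j)) (vanish (u j) (v j))) ⟩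
    Σℤ (λ c → coefficient j c * u j * v c) ∎
    where
    minor₂ : Fin (suc (suc k)) → Fin (suc k) → ℤ
    minor₂ j l = det k (λ r c → R r (punchIn j (punchIn l c)))
    regroup : ∀ s a t b d → s * a * (t * b * d) ≡ s * t * d * a * b
    regroup = solve-∀
    vanish : ∀ a b → + 0 * a * b ≡ + 0
    vanish = solve-∀

  expansion-antisym : ∀ u v → expansion v u ≡ - expansion u v
  expansion-antisym u v = begin
    expansion v u
      ≡⟨ expansion-double-sum v u ⟩
    Σℤ (λ j → Σℤ (λ c → coefficient j c * v j * u c))
      ≡⟨ Σℤ-comm (λ j c → coefficient j c * v j * u c) ⟩
    Σℤ (λ c → Σℤ (λ j → coefficient j c * v j * u c))
      ≡⟨ Σℤ-cong (λ c → Σℤ-cong (λ j → trans (cong (λ e → e * v j * u c) (coefficient-antisym j c))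
                                             (swap-factors (coefficient c j) (v j) (u c)))) ⟩
    Σℤ (λ c → Σℤ (λ j → - (coefficient c j * u c * v j)))
      ≡⟨ Σℤ-cong (λ c → neg-distrib-Σℤ (λ j → coefficient c j * u c * v j)) ⟨
    Σℤ (λ c → - Σℤ (λ j → coefficient c j * u c * v j))
      ≡⟨ neg-distrib-Σℤ (λ c → Σℤ (λ j → coefficient c j * u c * v j)) ⟨
    - Σℤ (λ c → Σℤ (λ j → coefficient c j * u c * v j))
      ≡⟨ cong -_ (expansion-double-sum u v) ⟨
    - expansion u v ∎
    where
    swap-factors : ∀ f a b → - f * a * b ≡ - (f * b * a)
    swap-factors = solve-∀

det-swap₀₁ : ∀ k (M M′ : Matrix (suc (suc k))) →
             (∀ c → M′ fzero c ≡ M (fsuc fzero) c) → (∀ c → M′ (fsuc fzero) c ≡ M fzero c) →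
             (∀ r c → M′ (fsuc (fsuc r)) c ≡ M (fsuc (fsuc r)) c) →
             det (suc (suc k)) M′ ≡ - det (suc (suc k)) M
det-swap₀₁ k M M′ row₀ row₁ rest =
  trans expand-M′ (expansion-antisym (M fzero) (M (fsuc fzero)))
  where
  open TwoRowExpansion k (λ r → M (fsuc (fsuc r)))
  expand-M′ : det (suc (suc k)) M′ ≡ expansion (M (fsuc fzero)) (M fzero)
  expand-M′ = Σℤ-cong λ j → cong₂ (λ a b → sign j * a * b) (row₀ j) (Σℤ-cong λ l →
    cong₂ (λ a b → sign l * a * b) (row₁ (punchIn j l)) (det-cong k (λ r c → rest r (punchIn j (punchIn l c)))))

RepeatedRowVanishes : ℕ → Set
RepeatedRowVanishes m = ∀ (M : Matrix m) i k → i ≢ k → (∀ c → M i c ≡ M k c) → det m M ≡ + 0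

self-negating⇒0 : ∀ {a : ℤ} → a ≡ - a → a ≡ + 0
self-negating⇒0 {+ zero}     _ = refl
self-negating⇒0 {+ suc n}    ()
self-negating⇒0 {ℤ.-[1+ n ]} ()

repeatedRow-below-top : ∀ m → RepeatedRowVanishes m → ∀ (M : Matrix (suc m)) i k → i ≢ k →
                        (∀ c → M (fsuc i) c ≡ M (fsuc k) c) → det (suc m) M ≡ + 0
repeatedRow-below-top m vanishes M i k i≢k rows≡ = Σℤ-zeros λ j →
  trans (cong (sign j * M fzero j *_) (vanishes (minor M j) i k i≢k (λ c → rows≡ (punchIn j c))))
        (ℤₚ.*-zeroʳ (sign j * M fzero j))

repeatedRow-with-top : ∀ m → RepeatedRowVanishes m → ∀ (M : Matrix (suc m)) k →
                       (∀ c → M fzero c ≡ M (fsuc k) c) → det (suc m) M ≡ + 0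
repeatedRow-with-top (suc m) vanishes M fzero rows≡ =
  self-negating⇒0 (det-swap₀₁ m M M rows≡ (sym ∘ rows≡) (λ r c → refl))
repeatedRow-with-top (suc m) vanishes M (fsuc k) rows≡ =
  trans (det-swap₀₁ m M′ M (λ c → refl) (λ c → refl) (λ r c → refl))
        (cong -_ (repeatedRow-below-top (suc m) vanishes M′ fzero (fsuc k) (λ ()) rows≡))
  where
  M′ : Matrix (suc (suc m))
  M′ fzero              = M (fsuc fzero)
  M′ (fsuc fzero)       = M fzero
  M′ (fsuc (fsuc r))    = M (fsuc (fsuc r))

det-repeatedRow : ∀ m → RepeatedRowVanishes m
det-repeatedRow (suc m) M fzero    fzero    i≢k _     = ⊥-elim (i≢k refl)
det-repeatedRow (suc m) M fzero    (fsuc k) _   rows≡ = repeatedRow-with-top m (det-repeatedRow m) M k rows≡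
det-repeatedRow (suc m) M (fsuc i) fzero    _   rows≡ = repeatedRow-with-top m (det-repeatedRow m) M i (sym ∘ rows≡)
det-repeatedRow (suc m) M (fsuc i) (fsuc k) i≢k rows≡ =
  repeatedRow-below-top m (det-repeatedRow m) M i k (i≢k ∘ cong fsuc) rows≡

module _ {m} (M : Matrix m) (t : Fin m) {f : (Fin m → ℤ) → Fin m → ℤ} where

  updateAt-row : ∀ c → updateAt M t f t c ≡ f (M t) c
  updateAt-row = cong-app (updateAt-updates t M)

  updateAt-otherRow : ∀ i → i ≢ t → ∀ c → updateAt M t f i c ≡ M i c
  updateAt-otherRow i i≢t = cong-app (updateAt-minimal i t M i≢t)

det-addCombination : ∀ m (M : Matrix m) (t : Fin m) p (C : Fin p → ℤ) (g : Fin p → Fin m) →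
  (∀ k → g k ≡ t → C k ≡ + 0) →
  det m (updateAt M t (λ u c → u c + Σℤ (λ k → C k * M (g k) c))) ≡ det m M
det-addCombination m M t zero C g _ = det-cong m entries
  where
  entries : ∀ i c → updateAt M t (λ u c → u c + + 0) i c ≡ M i c
  entries i c with i Finₚ.≟ t
  ... | yes refl = trans (updateAt-row M t c) (ℤₚ.+-identityʳ (M t c))
  ... | no i≢t  = updateAt-otherRow M t i i≢t c
det-addCombination m M t (suc p) C g Cg≡0 = begin
  det m (updateAt M t add-all)
    ≡⟨ det-linearAt m (updateAt M t add-rest) copy (updateAt M t add-all) t (+ 1) (C fzero)
         (λ i i≢t c → trans (updateAt-otherRow M t i i≢t c) (sym (updateAt-otherRow M t i i≢t c)))
         (λ i i≢t c → trans (updateAt-otherRow M t i i≢t c) (sym (updateAt-otherRow M t i i≢t c)))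
         (λ c → trans (updateAt-row M t c) (trans (split (M t c) (C fzero) (M (g fzero) c) _)
           (sym (cong₂ (λ a b → + 1 * a + C fzero * b) (updateAt-row M t c) (updateAt-row M t c))))) ⟩
  + 1 * det m (updateAt M t add-rest) + C fzero * det m copy
    ≡⟨ cong₂ (λ a b → + 1 * a + b) (det-addCombination m M t p (C ∘ fsuc) (g ∘ fsuc) (Cg≡0 ∘ fsuc)) copy-vanishes ⟩
  + 1 * det m M + + 0
    ≡⟨ tidy (det m M) ⟩
  det m M ∎
  where
  add-all add-rest : (Fin m → ℤ) → Fin m → ℤ
  add-all  u c = u c + Σℤ (λ k → C k * M (g k) c)
  add-rest u c = u c + Σℤ (λ k → C (fsuc k) * M (g (fsuc k)) c)
  split : ∀ a b x r → a + (b * x + r) ≡ + 1 * (a + r) + b * x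
  split = solve-∀
  tidy : ∀ d → + 1 * d + + 0 ≡ d
  tidy = solve-∀
  copy : Matrix m
  copy = updateAt M t (λ _ → M (g fzero))
  copy-vanishes : C fzero * det m copy ≡ + 0
  copy-vanishes with g fzero Finₚ.≟ t
  ... | yes g₀≡t = trans (cong (_* det m copy) (Cg≡0 fzero g₀≡t)) (ℤₚ.*-zeroˡ (det m copy))
  ... | no g₀≢t  = trans (cong (C fzero *_) (det-repeatedRow m copy t (g fzero) (g₀≢t ∘ sym)
                     (λ c → trans (updateAt-row M t c) (sym (updateAt-otherRow M t (g fzero) g₀≢t c)))))
                         (ℤₚ.*-zeroʳ (C fzero))

-- The rows of N replace those of M one at a time; each step is an instance of
-- det-addCombination because source rows are never replaced.
module AddCombinations (m : ℕ) (target : Fin m → Bool) (C : Matrix m) (M N : Matrix m)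
  (sources-kept : ∀ i k → target k ≡ true → C i k ≡ + 0)
  (targets-only : ∀ i k → target i ≡ false → C i k ≡ + 0)
  (N≡M+CM : ∀ i c → N i c ≡ M i c + Σℤ (λ k → C i k * M k c)) where

  rowsBelow : ℕ → Matrix m
  rowsBelow t i = if toℕ i ℕ.<ᵇ t then N i else M i

  rowsBelow-new : ∀ t i → toℕ i ℕ.< t → ∀ c → rowsBelow t i c ≡ N i c
  rowsBelow-new t i i<t c with toℕ i ℕ.<ᵇ t | ℕₚ.<⇒<ᵇ i<t
  ... | true | _ = refl

  rowsBelow-old : ∀ t i → ¬ toℕ i ℕ.< t → ∀ c → rowsBelow t i c ≡ M i c
  rowsBelow-old t i i≮t c with toℕ i ℕ.<ᵇ t | ℕₚ.<ᵇ⇒< (toℕ i) t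
  ... | true  | <ᵇ⇒< = ⊥-elim (i≮t (<ᵇ⇒< _))
  ... | false | _     = refl

  nonTarget-unchanged : ∀ k → target k ≡ false → ∀ c → N k c ≡ M k c
  nonTarget-unchanged k not-target c = begin
    N k c                                   ≡⟨ N≡M+CM k c ⟩
    M k c + Σℤ (λ k′ → C k k′ * M k′ c)   ≡⟨ cong (_+_ (M k c)) (Σℤ-zeros λ k′ →
                                                 trans (cong (_* M k′ c) (targets-only k k′ not-target)) (ℤₚ.*-zeroˡ (M k′ c))) ⟩
    M k c + + 0                             ≡⟨ ℤₚ.+-identityʳ (M k c) ⟩
    M k c                                   ∎

  weighted-source : ∀ t i k c → C i k * rowsBelow t k c ≡ C i k * M k c
  weighted-source t i k c with target k in target-k
  ... | true  = trans (cong (_* rowsBelow t k c) (sources-kept i k target-k))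
                      (sym (cong (_* M k c) (sources-kept i k target-k)))
  ... | false with toℕ k ℕ.<ᵇ t
  ...   | true  = cong (C i k *_) (nonTarget-unchanged k target-k c)
  ...   | false = refl

  C-diag : ∀ i → C i i ≡ + 0
  C-diag i with target i in target-i
  ... | true  = sources-kept i i target-i
  ... | false = targets-only i i target-i

  rowsBelow-suc : ∀ t (t<m : t ℕ.< m) → let i₀ = Fin.fromℕ< t<m in ∀ i c →
    rowsBelow (suc t) i c ≡ updateAt (rowsBelow t) i₀ (λ u c → u c + Σℤ (λ k → C i₀ k * rowsBelow t k c)) i c
  rowsBelow-suc t t<m i c with i Finₚ.≟ Fin.fromℕ< t<m
  ... | yes refl = begin
    rowsBelow (suc t) i₀ c
      ≡⟨ rowsBelow-new (suc t) i₀ (ℕ.s≤s (ℕₚ.≤-reflexive (Finₚ.toℕ-fromℕ< t<m))) c ⟩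
    N i₀ c
      ≡⟨ N≡M+CM i₀ c ⟩
    M i₀ c + Σℤ (λ k → C i₀ k * M k c)
      ≡⟨ cong₂ _+_ (sym (rowsBelow-old t i₀ (ℕₚ.<-irrefl (Finₚ.toℕ-fromℕ< t<m)) c))
                   (Σℤ-cong (λ k → sym (weighted-source t i₀ k c))) ⟩
    rowsBelow t i₀ c + Σℤ (λ k → C i₀ k * rowsBelow t k c)
      ≡⟨ updateAt-row (rowsBelow t) i₀ c ⟨
    updateAt (rowsBelow t) i₀ _ i₀ c ∎
    where i₀ = Fin.fromℕ< t<m
  ... | no i≢i₀ = trans unchanged (sym (updateAt-otherRow (rowsBelow t) (Fin.fromℕ< t<m) i i≢i₀ c))
    where
    i≢t : toℕ i ≢ t
    i≢t i≡t = i≢i₀ (Finₚ.toℕ-injective (trans i≡t (sym (Finₚ.toℕ-fromℕ< t<m))))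
    unchanged : rowsBelow (suc t) i c ≡ rowsBelow t i c
    unchanged with toℕ i ℕ.<? t
    ... | yes i<t = trans (rowsBelow-new (suc t) i (ℕₚ.m<n⇒m<1+n i<t) c) (sym (rowsBelow-new t i i<t c))
    ... | no i≮t  = trans (rowsBelow-old (suc t) i (λ i<1+t → i≮t (ℕₚ.≤∧≢⇒< (ℕₚ.≤-pred i<1+t) i≢t)) c)
                          (sym (rowsBelow-old t i i≮t c))

  det-rowsBelow : ∀ t → det m (rowsBelow t) ≡ det m M
  det-rowsBelow zero = det-cong m (λ i → rowsBelow-old zero i (λ ()))
  det-rowsBelow (suc t) with t ℕ.<? m
  ... | yes t<m = begin
    det m (rowsBelow (suc t))
      ≡⟨ det-cong m (rowsBelow-suc t t<m) ⟩
    det m (updateAt (rowsBelow t) i₀ (λ u c → u c + Σℤ (λ k → C i₀ k * rowsBelow t k c)))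
      ≡⟨ det-addCombination m (rowsBelow t) i₀ m (C i₀) (λ k → k) (λ { k refl → C-diag k }) ⟩
    det m (rowsBelow t)
      ≡⟨ det-rowsBelow t ⟩
    det m M ∎
    where i₀ = Fin.fromℕ< t<m
  ... | no t≮m = trans (det-cong m (λ i c → trans (rowsBelow-new (suc t) i (ℕₚ.m<n⇒m<1+n (i<t i)) c)
                                                  (sym (rowsBelow-new t i (i<t i) c))))
                       (det-rowsBelow t)
    where
    i<t : ∀ i → toℕ i ℕ.< t
    i<t i = ℕₚ.<-≤-trans (Finₚ.toℕ<n i) (ℕₚ.≮⇒≥ t≮m)

det-addCombinations : ∀ m (target : Fin m → Bool) (C : Matrix m) (M N : Matrix m) →
  (∀ i k → target k ≡ true → C i k ≡ + 0) → (∀ i k → target i ≡ false → C i k ≡ + 0) →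
  (∀ i c → N i c ≡ M i c + Σℤ (λ k → C i k * M k c)) → det m N ≡ det m M
det-addCombinations m target C M N sources-kept targets-only N≡M+CM =
  trans (det-cong m (λ i → sym ∘ rowsBelow-new m i (Finₚ.toℕ<n i))) (det-rowsBelow m)
  where open AddCombinations m target C M N sources-kept targets-only N≡M+CM

-- The characteristic matrix of the complete multipartite graph with parts of size 3

mixedRadix-< : ∀ a a′ r r′ → a ℕ.< a′ → r ℕ.≤ 2 → 3 ℕ.* a ℕ.+ r ℕ.< 3 ℕ.* a′ ℕ.+ r′
mixedRadix-< a a′ r r′ a<a′ r≤2 =
  ℕₚ.<-≤-trans (ℕₚ.+-monoʳ-< (3 ℕ.* a) (ℕ.s≤s r≤2))
    (ℕₚ.≤-trans (ℕₚ.≤-reflexive (trans (ℕₚ.+-comm (3 ℕ.* a) 3) (sym (ℕₚ.*-suc 3 a))))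
                (ℕₚ.≤-trans (ℕₚ.*-monoʳ-≤ 3 a<a′) (ℕₚ.m≤m+n (3 ℕ.* a′) r′)))

iverson : Bool → ℤ
iverson true  = + 1
iverson false = + 0

-- Indices of the 3B × 3B matrices are pairs (block, slot) ∈ Fin B × Fin 3, flattened by remQuot
-- as in A; the last index `pivot` is the row that collects the sum of all rows.
module BlockElimination (b : ℕ) (x : ℤ) where

  B m : ℕ
  B = suc b
  m = B ℕ.* 3

  block : Fin m → Fin B
  block i = proj₁ (remQuot {B} 3 i)

  slot : Fin m → Fin 3
  slot i = proj₂ (remQuot {B} 3 i)

  at : Fin B → Fin 3 → Fin m
  at = combine

  block-at : ∀ q r → block (at q r) ≡ q
  block-at q r = cong proj₁ (Finₚ.remQuot-combine {B} {3} q r)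

  slot-at : ∀ q r → slot (at q r) ≡ r
  slot-at q r = cong proj₂ (Finₚ.remQuot-combine {B} {3} q r)

  at-block-slot : ∀ i → at (block i) (slot i) ≡ i
  at-block-slot = Finₚ.combine-remQuot {B} 3

  block-slot-injective : ∀ {i j} → block i ≡ block j → slot i ≡ slot j → i ≡ j
  block-slot-injective {i} {j} q≡ r≡ =
    trans (sym (at-block-slot i)) (trans (cong₂ at q≡ r≡) (at-block-slot j))

  δ-block-slot : ∀ i j → δ i j ≡ δ (block i) (block j) * δ (slot i) (slot j)
  δ-block-slot i j with i Finₚ.≟ j
  ... | yes refl = sym (cong₂ _*_ (δ-refl (block i)) (δ-refl (slot i)))
  ... | no i≢j with block i Finₚ.≟ block j | slot i Finₚ.≟ slot j
  ...   | yes q≡ | yes r≡ = ⊥-elim (i≢j (block-slot-injective q≡ r≡))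
  ...   | yes _  | no _   = refl
  ...   | no _   | _      = refl

  toℕ-block-slot : ∀ i → toℕ i ≡ 3 ℕ.* toℕ (block i) ℕ.+ toℕ (slot i)
  toℕ-block-slot i = trans (cong toℕ (sym (at-block-slot i))) (Finₚ.toℕ-combine {B} {3} (block i) (slot i))

  lastBlock : Fin B
  lastBlock = Fin.fromℕ b

  isLast : Fin B → Bool
  isLast q = does (q Finₚ.≟ lastBlock)

  isLast⇒≡ : ∀ q → isLast q ≡ true → q ≡ lastBlock
  isLast⇒≡ q _ with q Finₚ.≟ lastBlock
  ... | yes q≡ = q≡

  isLast-lastBlock : isLast lastBlock ≡ true
  isLast-lastBlock with lastBlock Finₚ.≟ lastBlock
  ... | yes _  = refl
  ... | no ≢  = ⊥-elim (≢ refl)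

  BlockMatrix : Set
  BlockMatrix = Fin B → Fin 3 → Fin B → Fin 3 → ℤ

  flatten : BlockMatrix → Matrix m
  flatten R i c = R (block i) (slot i) (block c) (slot c)

  flatten-at : ∀ R q r c → flatten R (at q r) c ≡ R q r (block c) (slot c)
  flatten-at R q r c = cong₂ (λ q′ r′ → R q′ r′ (block c) (slot c)) (block-at q r) (slot-at q r)

  pivot : Fin m
  pivot = at lastBlock 2F

  isPivot : Fin B → Fin 3 → Bool
  isPivot q 0F = false
  isPivot q 1F = false
  isPivot q 2F = isLast q

  isPivot⇒≡ : ∀ k → isPivot (block k) (slot k) ≡ true → k ≡ pivot
  isPivot⇒≡ k is with slot k in slot≡
  ... | 2F = block-slot-injective (trans (isLast⇒≡ (block k) is) (sym (block-at lastBlock 2F)))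
                                  (trans slot≡ (sym (slot-at lastBlock 2F)))

  isPivot-pivot : isPivot (block pivot) (slot pivot) ≡ true
  isPivot-pivot = subst₂ (λ q r → isPivot q r ≡ true)
    (sym (block-at lastBlock 2F)) (sym (slot-at lastBlock 2F)) isLast-lastBlock

  isPivot-≟ : ∀ i → isPivot (block i) (slot i) ≡ does (i Finₚ.≟ pivot)
  isPivot-≟ i with i Finₚ.≟ pivot
  ... | yes refl = isPivot-pivot
  ... | no i≢p with isPivot (block i) (slot i) in is
  ...   | true  = ⊥-elim (i≢p (isPivot⇒≡ i is))
  ...   | false = refl

  withPivotRow : ℤ → BlockMatrix → BlockMatrix
  withPivotRow v R q r q′ r′ = if isPivot q r then v else R q r q′ r′

  flatten-withPivotRow : ∀ v R i c →
    flatten (withPivotRow v R) i c ≡ (if does (i Finₚ.≟ pivot) then v else flatten R i c)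
  flatten-withPivotRow v R i c = cong (λ is → if is then v else flatten R i c) (isPivot-≟ i)

  flatten-withPivotRow-pivot : ∀ v R c → flatten (withPivotRow v R) pivot c ≡ v
  flatten-withPivotRow-pivot v R c = cong (λ is → if is then v else flatten R pivot c) isPivot-pivot

  charMatrix : BlockMatrix
  charMatrix q r q′ r′ = x * (δ q q′ * δ r r′) - (+ 1 - δ q q′)

  charMatrix-blockColumnSum : ∀ q q′ r′ → Σℤ (λ r → charMatrix q r q′ r′) ≡ (x + + 3) * δ q q′ - + 3
  charMatrix-blockColumnSum q q′ r′ = begin
    Σℤ (λ r → x * (δ q q′ * δ r r′) - (+ 1 - δ q q′))
      ≡⟨ Σℤ-distrib-+ (λ r → x * (δ q q′ * δ r r′)) (λ _ → - (+ 1 - δ q q′)) ⟩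
    Σℤ (λ r → x * (δ q q′ * δ r r′)) + Σℤ {3} (λ _ → - (+ 1 - δ q q′))
      ≡⟨ cong₂ _+_ (trans (Σℤ-cong (λ r → sym (ℤₚ.*-assoc x (δ q q′) (δ r r′)))) (Σℤ-δ′ (x * δ q q′) r′))
                   (Σℤ-const 3 (- (+ 1 - δ q q′))) ⟩
    x * δ q q′ + + 3 * - (+ 1 - δ q q′)
      ≡⟨ collect x (δ q q′) ⟩
    (x + + 3) * δ q q′ - + 3 ∎
    where
    collect : ∀ x a → x * a + + 3 * - (+ 1 - a) ≡ (x + + 3) * a - + 3
    collect = solve-∀

  charMatrix-columnSum : ∀ c → Σℤ (λ k → flatten charMatrix k c) ≡ x - + 3 * + b
  charMatrix-columnSum c = begin
    Σℤ (λ k → flatten charMatrix k c)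
      ≡⟨ Σℤ-combine B 3 (λ k → flatten charMatrix k c) ⟩
    Σℤ (λ q → Σℤ (λ r → flatten charMatrix (at q r) c))
      ≡⟨ Σℤ-cong (λ q → trans (Σℤ-cong (λ r → flatten-at charMatrix q r c))
                              (charMatrix-blockColumnSum q (block c) (slot c))) ⟩
    Σℤ (λ q → (x + + 3) * δ q (block c) - + 3)
      ≡⟨ Σℤ-distrib-+ (λ q → (x + + 3) * δ q (block c)) (λ _ → - + 3) ⟩
    Σℤ (λ q → (x + + 3) * δ q (block c)) + Σℤ {B} (λ _ → - + 3)
      ≡⟨ cong₂ _+_ (Σℤ-δ′ (x + + 3) (block c)) (Σℤ-const B (- + 3)) ⟩
    (x + + 3) + + B * - + 3
      ≡⟨ collect x (+ b) ⟩
    x - + 3 * + b ∎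
    where
    collect : ∀ x b → (x + + 3) + (+ 1 + b) * - + 3 ≡ x - + 3 * b
    collect = solve-∀

  det-withPivotRow : ∀ v R → det m (flatten (withPivotRow v R)) ≡ v * det m (flatten (withPivotRow (+ 1) R))
  det-withPivotRow v R =
    trans (det-scaleRows m scale (flatten (withPivotRow (+ 1) R)) (flatten (withPivotRow v R)) rows)
          (cong (_* det m (flatten (withPivotRow (+ 1) R))) (Πℤ-single pivot v))
    where
    scale : Fin m → ℤ
    scale i = if does (i Finₚ.≟ pivot) then v else + 1
    rows : ∀ i c → flatten (withPivotRow v R) i c ≡ scale i * flatten (withPivotRow (+ 1) R) i c
    rows i c rewrite flatten-withPivotRow v R i c | flatten-withPivotRow (+ 1) R i c with i Finₚ.≟ pivot
    ... | yes _ = sym (ℤₚ.*-identityʳ v)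
    ... | no _  = sym (ℤₚ.*-identityˡ (flatten R i c))

  pivot-update : ∀ i (y : Fin m → ℤ) v → (if does (i Finₚ.≟ pivot) then v else y i) ≡ y i + δ i pivot * (v - y pivot)
  pivot-update i y v with i Finₚ.≟ pivot
  ... | yes refl = sym (replaced v (y i))
    where
    replaced : ∀ v y → y + + 1 * (v - y) ≡ v
    replaced = solve-∀
  ... | no _ = sym (kept (y i) (v - y pivot))
    where
    kept : ∀ y z → y + + 0 * z ≡ y
    kept = solve-∀

  det-sumInPivot : det m (flatten (withPivotRow (x - + 3 * + b) charMatrix)) ≡ det m (flatten charMatrix)
  det-sumInPivot = det-addCombinations m isPivotRow C M _ pivot-kept others-kept rows
    where
    M : Matrix m
    M = flatten charMatrix
    isPivotRow : Fin m → Bool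
    isPivotRow i = does (i Finₚ.≟ pivot)
    C : Matrix m
    C i k = δ i pivot * (+ 1 - δ k pivot)
    pivot-kept : ∀ i k → isPivotRow k ≡ true → C i k ≡ + 0
    pivot-kept i k _ with k Finₚ.≟ pivot
    ... | yes refl = ℤₚ.*-zeroʳ (δ i pivot)
    others-kept : ∀ i k → isPivotRow i ≡ false → C i k ≡ + 0
    others-kept i k _ with i Finₚ.≟ pivot
    ... | no _ = ℤₚ.*-zeroˡ (+ 1 - δ k pivot)
    rows : ∀ i c → flatten (withPivotRow (x - + 3 * + b) charMatrix) i c ≡ M i c + Σℤ (λ k → C i k * M k c)
    rows i c = begin
      flatten (withPivotRow (x - + 3 * + b) charMatrix) i c
        ≡⟨ flatten-withPivotRow (x - + 3 * + b) charMatrix i c ⟩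
      (if does (i Finₚ.≟ pivot) then x - + 3 * + b else M i c)
        ≡⟨ pivot-update i (λ k → M k c) (x - + 3 * + b) ⟩
      M i c + δ i pivot * (x - + 3 * + b - M pivot c)
        ≡⟨ cong (λ s → M i c + δ i pivot * (s - M pivot c)) (charMatrix-columnSum c) ⟨
      M i c + δ i pivot * (Σℤ (λ k → M k c) - M pivot c)
        ≡⟨ cong (_+_ (M i c)) (Σℤ-except (δ i pivot) pivot (λ k → M k c)) ⟨
      M i c + Σℤ (λ k → C i k * M k c) ∎

  diagonalBlocks : BlockMatrix
  diagonalBlocks q r q′ r′ = x * (δ q q′ * δ r r′) + δ q q′

  det-diagonalBlocks : det m (flatten (withPivotRow (+ 1) diagonalBlocks)) ≡ det m (flatten (withPivotRow (+ 1) charMatrix))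
  det-diagonalBlocks = det-addCombinations m nonPivotRow C M _ pivot-kept others-kept rows
    where
    M : Matrix m
    M = flatten (withPivotRow (+ 1) charMatrix)
    nonPivotRow : Fin m → Bool
    nonPivotRow i = not (does (i Finₚ.≟ pivot))
    C : Matrix m
    C i k = (+ 1 - δ i pivot) * δ k pivot
    pivot-kept : ∀ i k → nonPivotRow k ≡ true → C i k ≡ + 0
    pivot-kept i k _ with k Finₚ.≟ pivot
    ... | no _ = ℤₚ.*-zeroʳ (+ 1 - δ i pivot)
    others-kept : ∀ i k → nonPivotRow i ≡ false → C i k ≡ + 0
    others-kept i k _ with i Finₚ.≟ pivot
    ... | yes refl = ℤₚ.*-zeroˡ (δ k pivot)
    add-ones : ∀ i c → (if does (i Finₚ.≟ pivot) then + 1 else flatten diagonalBlocks i c) ≡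
                       (if does (i Finₚ.≟ pivot) then + 1 else flatten charMatrix i c) + (+ 1 - δ i pivot) * + 1
    add-ones i c with i Finₚ.≟ pivot
    ... | yes _ = refl
    ... | no _  = unshift x (δ (block i) (block c)) (δ (slot i) (slot c))
      where
      unshift : ∀ x a d → x * (a * d) + a ≡ x * (a * d) - (+ 1 - a) + (+ 1 - + 0) * + 1
      unshift = solve-∀
    rows : ∀ i c → flatten (withPivotRow (+ 1) diagonalBlocks) i c ≡ M i c + Σℤ (λ k → C i k * M k c)
    rows i c = begin
      flatten (withPivotRow (+ 1) diagonalBlocks) i c
        ≡⟨ flatten-withPivotRow (+ 1) diagonalBlocks i c ⟩
      (if does (i Finₚ.≟ pivot) then + 1 else flatten diagonalBlocks i c)
        ≡⟨ add-ones i c ⟩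
      (if does (i Finₚ.≟ pivot) then + 1 else flatten charMatrix i c) + (+ 1 - δ i pivot) * + 1
        ≡⟨ cong₂ (λ y z → y + (+ 1 - δ i pivot) * z) (flatten-withPivotRow (+ 1) charMatrix i c)
                                                     (flatten-withPivotRow-pivot (+ 1) charMatrix c) ⟨
      M i c + (+ 1 - δ i pivot) * M pivot c
        ≡⟨ cong (_+_ (M i c)) (Σℤ-δ (+ 1 - δ i pivot) pivot (λ k → M k c)) ⟨
      M i c + Σℤ (λ k → C i k * M k c) ∎

  isDifferenceRow : Fin B → Fin 3 → Bool
  isDifferenceRow q 0F = false
  isDifferenceRow q 1F = true
  isDifferenceRow q 2F = not (isLast q)

  differences : ℤ → BlockMatrix
  differences v q r q′ r′ = if isDifferenceRow q r
    then v * (δ q q′ * (δ r r′ - δ 0F r′))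
    else withPivotRow (+ 1) diagonalBlocks q r q′ r′

  subtract-firstRow : ∀ x a d d₀ → x * (a * (d - d₀)) ≡ x * (a * d) + a + - + 1 * (x * (a * d₀) + a)
  subtract-firstRow = solve-∀

  differences≡diagonalBlocks-firstRow : ∀ q r q′ r′ → differences x q r q′ r′ ≡
    withPivotRow (+ 1) diagonalBlocks q r q′ r′ + (- iverson (isDifferenceRow q r)) * diagonalBlocks q 0F q′ r′
  differences≡diagonalBlocks-firstRow q 0F q′ r′ = sym (unchanged (diagonalBlocks q 0F q′ r′) (diagonalBlocks q 0F q′ r′))
    where
    unchanged : ∀ y z → y + - + 0 * z ≡ y
    unchanged = solve-∀
  differences≡diagonalBlocks-firstRow q 1F q′ r′ = subtract-firstRow x (δ q q′) (δ 1F r′) (δ 0F r′)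
  differences≡diagonalBlocks-firstRow q 2F q′ r′ with isLast q
  ... | true  = refl
  ... | false = subtract-firstRow x (δ q q′) (δ 2F r′) (δ 0F r′)

  det-differences : det m (flatten (differences x)) ≡ det m (flatten (withPivotRow (+ 1) diagonalBlocks))
  det-differences = det-addCombinations m isDifference C
    (flatten (withPivotRow (+ 1) diagonalBlocks)) (flatten (differences x)) firstRows-kept others-kept rows
    where
    isDifference : Fin m → Bool
    isDifference i = isDifferenceRow (block i) (slot i)
    C : Matrix m
    C i k = (- iverson (isDifference i)) * δ k (at (block i) 0F)
    firstRows-kept : ∀ i k → isDifference k ≡ true → C i k ≡ + 0
    firstRows-kept i k is with k Finₚ.≟ at (block i) 0F
    ... | yes refl = ⊥-elim (false≢true (trans (sym (cong (isDifferenceRow (block (at (block i) 0F))) (slot-at (block i) 0F))) is))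
      where
      false≢true : false ≢ true
      false≢true ()
    ... | no _ = ℤₚ.*-zeroʳ (- iverson (isDifference i))
    others-kept : ∀ i k → isDifference i ≡ false → C i k ≡ + 0
    others-kept i k not rewrite not = ℤₚ.*-zeroˡ (δ k (at (block i) 0F))
    rows : ∀ i c → flatten (differences x) i c ≡
           flatten (withPivotRow (+ 1) diagonalBlocks) i c + Σℤ (λ k → C i k * flatten (withPivotRow (+ 1) diagonalBlocks) k c)
    rows i c = trans (differences≡diagonalBlocks-firstRow (block i) (slot i) (block c) (slot c))
                     (cong (_+_ (flatten (withPivotRow (+ 1) diagonalBlocks) i c))
                 (sym (trans (Σℤ-δ (- iverson (isDifference i)) (at (block i) 0F) (λ k → flatten (withPivotRow (+ 1) diagonalBlocks) k c))
                             (cong ((- iverson (isDifference i)) *_) (flatten-at (withPivotRow (+ 1) diagonalBlocks) (block i) 0F c)))))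

  det-differences-scale : det m (flatten (differences x)) ≡ ((x * x) ^ b * x) * det m (flatten (differences (+ 1)))
  det-differences-scale =
    trans (det-scaleRows m scale (flatten (differences (+ 1))) (flatten (differences x)) rows)
          (cong (_* det m (flatten (differences (+ 1)))) Πscale)
    where
    scaleAt : Fin B → Fin 3 → ℤ
    scaleAt q r = if isDifferenceRow q r then x else + 1
    scale : Fin m → ℤ
    scale i = scaleAt (block i) (slot i)
    row : ∀ q r q′ r′ → differences x q r q′ r′ ≡ scaleAt q r * differences (+ 1) q r q′ r′
    row q r q′ r′ with isDifferenceRow q r
    ... | true  = cong (x *_) (sym (ℤₚ.*-identityˡ (δ q q′ * (δ r r′ - δ 0F r′))))
    ... | false = sym (ℤₚ.*-identityˡ (withPivotRow (+ 1) diagonalBlocks q r q′ r′))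
    rows : ∀ i c → flatten (differences x) i c ≡ scale i * flatten (differences (+ 1)) i c
    rows i c = row (block i) (slot i) (block c) (slot c)
    blockScale : ∀ q → Πℤ (scaleAt q) ≡ (if isLast q then x else x * x)
    blockScale q with isLast q
    ... | true  = product x
      where
      product : ∀ x → + 1 * (x * (+ 1 * + 1)) ≡ x
      product = solve-∀
    ... | false = product x
      where
      product : ∀ x → + 1 * (x * (x * + 1)) ≡ x * x
      product = solve-∀
    Πscale : Πℤ scale ≡ (x * x) ^ b * x
    Πscale = begin
      Πℤ scale                                        ≡⟨ Πℤ-combine B 3 scale ⟩
      Πℤ (λ q → Πℤ (λ r → scale (at q r)))            ≡⟨ Πℤ-cong (λ q → Πℤ-cong (λ r → cong₂ scaleAt (block-at q r) (slot-at q r))) ⟩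
      Πℤ (λ q → Πℤ (scaleAt q))                       ≡⟨ Πℤ-cong blockScale ⟩
      Πℤ (λ q → if isLast q then x else x * x)        ≡⟨ Πℤ-last b x (x * x) ⟩
      (x * x) ^ b * x                                 ∎

  triangular : BlockMatrix
  triangular q 0F q′ r′ = if isLast q then x * (δ q q′ * δ 0F r′) + δ q q′ - + 1
                                      else (x + + 3) * (δ q q′ * δ 0F r′)
  triangular q 1F q′ r′ = δ q q′ * (δ 1F r′ - δ 0F r′)
  triangular q 2F q′ r′ = if isLast q then + 1 else δ q q′ * (δ 2F r′ - δ 0F r′)

  isFirst : Fin 3 → Bool
  isFirst 0F = true
  isFirst 1F = false
  isFirst 2F = false

  -- In the last block only the pivot row is subtracted from the first row.
  coefficient₁ coefficient₂ : Fin B → Fin 3 → ℤ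
  coefficient₁ q r = - iverson (isFirst r ∧ not (isLast q))
  coefficient₂ q r = - iverson (isFirst r)

  δ-slots : ∀ (r′ : Fin 3) → + 1 - (δ 0F r′ + δ 1F r′ + δ 2F r′) ≡ + 0
  δ-slots 0F = refl
  δ-slots 1F = refl
  δ-slots 2F = refl

  otherRows-unchanged : ∀ a d d₀ y z → a * (d - d₀) ≡ + 1 * (a * (d - d₀)) + (- + 0 * y + - + 0 * z)
  otherRows-unchanged = solve-∀

  triangular≡differences-otherRows : ∀ q r q′ r′ → triangular q r q′ r′ ≡ differences (+ 1) q r q′ r′ +
          (coefficient₁ q r * differences (+ 1) q 1F q′ r′ + coefficient₂ q r * differences (+ 1) q 2F q′ r′)
  triangular≡differences-otherRows q 0F q′ r′ with isLast q
  ... | true = subtract-pivot x (δ q q′) (δ 0F r′) (differences (+ 1) q 1F q′ r′)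
    where
    subtract-pivot : ∀ x a d₀ y → x * (a * d₀) + a - + 1 ≡ x * (a * d₀) + a + (- + 0 * y + - + 1 * + 1)
    subtract-pivot = solve-∀
  ... | false = sym (begin
    x * (a * δ 0F r′) + a + (- + 1 * (+ 1 * (a * (δ 1F r′ - δ 0F r′))) + - + 1 * (+ 1 * (a * (δ 2F r′ - δ 0F r′))))
      ≡⟨ subtract-block x a (δ 0F r′) (δ 1F r′) (δ 2F r′) ⟩
    (x + + 3) * (a * δ 0F r′) + a * (+ 1 - (δ 0F r′ + δ 1F r′ + δ 2F r′))
      ≡⟨ cong (λ s → (x + + 3) * (a * δ 0F r′) + a * s) (δ-slots r′) ⟩
    (x + + 3) * (a * δ 0F r′) + a * + 0
      ≡⟨ drop (x + + 3) a (δ 0F r′) ⟩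
    (x + + 3) * (a * δ 0F r′) ∎)
    where
    a = δ q q′
    subtract-block : ∀ x a d₀ d₁ d₂ →
      x * (a * d₀) + a + (- + 1 * (+ 1 * (a * (d₁ - d₀))) + - + 1 * (+ 1 * (a * (d₂ - d₀)))) ≡
      (x + + 3) * (a * d₀) + a * (+ 1 - (d₀ + d₁ + d₂))
    subtract-block = solve-∀
    drop : ∀ y a d → y * (a * d) + a * + 0 ≡ y * (a * d)
    drop = solve-∀
  triangular≡differences-otherRows q 1F q′ r′ =
    otherRows-unchanged (δ q q′) (δ 1F r′) (δ 0F r′) (differences (+ 1) q 1F q′ r′) (differences (+ 1) q 2F q′ r′)
  triangular≡differences-otherRows q 2F q′ r′ with isLast q
  ... | true  = sym (ℤₚ.+-identityʳ (+ 1))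
  ... | false = otherRows-unchanged (δ q q′) (δ 2F r′) (δ 0F r′) (differences (+ 1) q 1F q′ r′)
                                    (+ 1 * (δ q q′ * (δ 2F r′ - δ 0F r′)))

  det-triangular : det m (flatten triangular) ≡ det m (flatten (differences (+ 1)))
  det-triangular = det-addCombinations m isFirstRow C (flatten (differences (+ 1))) (flatten triangular)
                                       others-kept firstRows-only rows
    where
    isFirstRow : Fin m → Bool
    isFirstRow i = isFirst (slot i)
    C : Matrix m
    C i k = coefficient₁ (block i) (slot i) * δ k (at (block i) 1F) + coefficient₂ (block i) (slot i) * δ k (at (block i) 2F)
    first≢ : ∀ k q r → isFirstRow k ≡ true → isFirst r ≡ false → k ≢ at q r
    first≢ k q r is isn't refl = true≢false (trans (sym is) (trans (cong isFirst (slot-at q r)) isn't))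
      where
      true≢false : true ≢ false
      true≢false ()
    others-kept : ∀ i k → isFirstRow k ≡ true → C i k ≡ + 0
    others-kept i k is =
      trans (cong₂ (λ d₁ d₂ → coefficient₁ (block i) (slot i) * d₁ + coefficient₂ (block i) (slot i) * d₂)
                   (δ-≢ (first≢ k (block i) 1F is refl)) (δ-≢ (first≢ k (block i) 2F is refl)))
            (vanish (coefficient₁ (block i) (slot i)) (coefficient₂ (block i) (slot i)))
      where
      vanish : ∀ a b → a * + 0 + b * + 0 ≡ + 0
      vanish = solve-∀
    firstRows-only : ∀ i k → isFirstRow i ≡ false → C i k ≡ + 0
    firstRows-only i k isn't rewrite isn't = vanish (δ k (at (block i) 1F)) (δ k (at (block i) 2F))
      where
      vanish : ∀ a b → - + 0 * a + - + 0 * b ≡ + 0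
      vanish = solve-∀
    rows : ∀ i c → flatten triangular i c ≡
           flatten (differences (+ 1)) i c + Σℤ (λ k → C i k * flatten (differences (+ 1)) k c)
    rows i c = trans (triangular≡differences-otherRows (block i) (slot i) (block c) (slot c)) (cong (_+_ (flatten (differences (+ 1)) i c)) (sym (begin
      Σℤ (λ k → C i k * flatten (differences (+ 1)) k c)
        ≡⟨ Σℤ-δ₂ (coefficient₁ (block i) (slot i)) (coefficient₂ (block i) (slot i)) (at (block i) 1F) (at (block i) 2F)
                 (λ k → flatten (differences (+ 1)) k c) ⟩
      coefficient₁ (block i) (slot i) * flatten (differences (+ 1)) (at (block i) 1F) c +
      coefficient₂ (block i) (slot i) * flatten (differences (+ 1)) (at (block i) 2F) c
        ≡⟨ cong₂ (λ y z → coefficient₁ (block i) (slot i) * y + coefficient₂ (block i) (slot i) * z)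
                 (flatten-at (differences (+ 1)) (block i) 1F c) (flatten-at (differences (+ 1)) (block i) 2F c) ⟩
      coefficient₁ (block i) (slot i) * differences (+ 1) (block i) 1F (block c) (slot c) +
      coefficient₂ (block i) (slot i) * differences (+ 1) (block i) 2F (block c) (slot c) ∎)))

  triangular-firstRow : ∀ q r′ → δ 0F r′ ≡ + 0 → triangular q 0F q r′ ≡ + 0
  triangular-firstRow q r′ off rewrite δ-refl q | off with isLast q
  ... | true  = vanish x
    where
    vanish : ∀ x → x * (+ 1 * + 0) + + 1 - + 1 ≡ + 0
    vanish = solve-∀
  ... | false = vanish x
    where
    vanish : ∀ x → (x + + 3) * (+ 1 * + 0) ≡ + 0
    vanish = solve-∀

  triangular-sameBlock : ∀ q r r′ → toℕ r ℕ.< toℕ r′ → triangular q r q r′ ≡ + 0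
  triangular-sameBlock q 0F 0F ()
  triangular-sameBlock q 0F 1F _ = triangular-firstRow q 1F refl
  triangular-sameBlock q 0F 2F _ = triangular-firstRow q 2F refl
  triangular-sameBlock q 1F 0F ()
  triangular-sameBlock q 1F 1F (ℕ.s≤s ())
  triangular-sameBlock q 1F 2F _ = ℤₚ.*-zeroʳ (δ q q)
  triangular-sameBlock q 2F 0F ()
  triangular-sameBlock q 2F 1F (ℕ.s≤s ())
  triangular-sameBlock q 2F 2F (ℕ.s≤s (ℕ.s≤s ()))

  triangular-otherBlock : ∀ q r q′ r′ → q ≢ q′ → isLast q ≡ false → triangular q r q′ r′ ≡ + 0
  triangular-otherBlock q 0F q′ r′ q≢q′ notLast rewrite notLast | δ-≢ q≢q′ = vanish (x + + 3) (δ 0F r′)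
    where
    vanish : ∀ y d → y * (+ 0 * d) ≡ + 0
    vanish = solve-∀
  triangular-otherBlock q 1F q′ r′ q≢q′ notLast rewrite δ-≢ q≢q′ = ℤₚ.*-zeroˡ (δ 1F r′ - δ 0F r′)
  triangular-otherBlock q 2F q′ r′ q≢q′ notLast rewrite notLast | δ-≢ q≢q′ = ℤₚ.*-zeroˡ (δ 2F r′ - δ 0F r′)

  lastBlock-maximal : ∀ q (r : Fin 3) q′ (r′ : Fin 3) → isLast q ≡ true →
                      3 ℕ.* toℕ q ℕ.+ toℕ r ℕ.< 3 ℕ.* toℕ q′ ℕ.+ toℕ r′ → q′ ≡ q
  lastBlock-maximal q r q′ r′ last lt with toℕ q′ ℕ.<? b
  ... | yes q′<b = ⊥-elim (ℕₚ.<-asym lt (mixedRadix-< (toℕ q′) (toℕ q) (toℕ r′) (toℕ r) q′<q (Finₚ.toℕ≤pred[n] r′)))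
    where
    q′<q : toℕ q′ ℕ.< toℕ q
    q′<q = subst (toℕ q′ ℕ.<_) (sym (trans (cong toℕ (isLast⇒≡ q last)) (Finₚ.toℕ-fromℕ b))) q′<b
  ... | no q′≮b = trans (Finₚ.toℕ-injective (trans (ℕₚ.≤-antisym (Finₚ.toℕ≤pred[n] q′) (ℕₚ.≮⇒≥ q′≮b))
                                                   (sym (Finₚ.toℕ-fromℕ b))))
                        (sym (isLast⇒≡ q last))

  triangular-upper : ∀ q (r : Fin 3) q′ (r′ : Fin 3) → 3 ℕ.* toℕ q ℕ.+ toℕ r ℕ.< 3 ℕ.* toℕ q′ ℕ.+ toℕ r′ → triangular q r q′ r′ ≡ + 0
  triangular-upper q r q′ r′ lt with q Finₚ.≟ q′ | isLast q in last
  ... | yes refl | _     = triangular-sameBlock q r r′ (ℕₚ.+-cancelˡ-< (3 ℕ.* toℕ q) (toℕ r) (toℕ r′) lt)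
  ... | no q≢q′  | true  = ⊥-elim (q≢q′ (sym (lastBlock-maximal q r q′ r′ last lt)))
  ... | no q≢q′  | false = triangular-otherBlock q r q′ r′ q≢q′ last

  triangular-lower : ∀ i c → toℕ i ℕ.< toℕ c → flatten triangular i c ≡ + 0
  triangular-lower i c lt =
    triangular-upper (block i) (slot i) (block c) (slot c) (subst₂ ℕ._<_ (toℕ-block-slot i) (toℕ-block-slot c) lt)

  triangular-blockDiagonal : ∀ q → Πℤ (λ r → triangular q r q r) ≡ (if isLast q then x else x + + 3)
  triangular-blockDiagonal q rewrite δ-refl q with isLast q
  ... | true  = product x
    where
    product : ∀ x → (x * (+ 1 * + 1) + + 1 - + 1) * (+ 1 * (+ 1 - + 0) * (+ 1 * + 1)) ≡ x
    product = solve-∀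
  ... | false = product x
    where
    product : ∀ x → (x + + 3) * (+ 1 * + 1) * (+ 1 * (+ 1 - + 0) * (+ 1 * (+ 1 - + 0) * + 1)) ≡ x + + 3
    product = solve-∀

  triangular-diagonal : Πℤ (λ i → flatten triangular i i) ≡ (x + + 3) ^ b * x
  triangular-diagonal = begin
    Πℤ (λ i → flatten triangular i i)
      ≡⟨ Πℤ-combine B 3 (λ i → flatten triangular i i) ⟩
    Πℤ (λ q → Πℤ (λ r → flatten triangular (at q r) (at q r)))
      ≡⟨ Πℤ-cong (λ q → Πℤ-cong (λ r → trans (flatten-at triangular q r (at q r))
                                             (cong₂ (triangular q r) (block-at q r) (slot-at q r)))) ⟩
    Πℤ (λ q → Πℤ (λ r → triangular q r q r))
      ≡⟨ Πℤ-cong triangular-blockDiagonal ⟩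
    Πℤ (λ q → if isLast q then x else x + + 3)
      ≡⟨ Πℤ-last b x (x + + 3) ⟩
    (x + + 3) ^ b * x ∎

  det-charMatrix : det m (flatten charMatrix) ≡ (x - + 3 * + b) * (((x * x) ^ b * x) * ((x + + 3) ^ b * x))
  det-charMatrix = begin
    det m (flatten charMatrix)
      ≡⟨ det-sumInPivot ⟨
    det m (flatten (withPivotRow (x - + 3 * + b) charMatrix))
      ≡⟨ det-withPivotRow (x - + 3 * + b) charMatrix ⟩
    (x - + 3 * + b) * det m (flatten (withPivotRow (+ 1) charMatrix))
      ≡⟨ cong ((x - + 3 * + b) *_) (begin
        det m (flatten (withPivotRow (+ 1) charMatrix))      ≡⟨ det-diagonalBlocks ⟨
        det m (flatten (withPivotRow (+ 1) diagonalBlocks))  ≡⟨ det-differences ⟨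
        det m (flatten (differences x))                      ≡⟨ det-differences-scale ⟩
        ((x * x) ^ b * x) * det m (flatten (differences (+ 1)))
          ≡⟨ cong (((x * x) ^ b * x) *_) (trans (sym det-triangular)
               (trans (det-lowerTriangular m (flatten triangular) triangular-lower) triangular-diagonal)) ⟩
        ((x * x) ^ b * x) * ((x + + 3) ^ b * x) ∎) ⟩
    (x - + 3 * + b) * (((x * x) ^ b * x) * ((x + + 3) ^ b * x)) ∎

-- The Cayley graph of U_{6n}

module Translation (N : ℕ) .{{_ : ℕ.NonZero N}} where

  translate-fixed⇒0 : ∀ t a → t ℕ.< N → a ℕ.< N → (t ℕ.+ a) % N ≡ a → t ≡ 0
  translate-fixed⇒0 t a t<N a<N fixed with (t ℕ.+ a) ℕ.<? N
  ... | yes t+a<N = ℕₚ.+-cancelʳ-≡ a t 0 (trans (sym (m<n⇒m%n≡m t+a<N)) fixed)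
  ... | no t+a≮N = ⊥-elim (ℕₚ.<-irrefl t≡N t<N)
    where
    N≤t+a : N ℕ.≤ t ℕ.+ a
    N≤t+a = ℕₚ.≮⇒≥ t+a≮N
    wrapped<N : t ℕ.+ a ℕ.∸ N ℕ.< N
    wrapped<N = ℕₚ.+-cancelʳ-< N (t ℕ.+ a ℕ.∸ N) N
      (subst (ℕ._< N ℕ.+ N) (sym (ℕₚ.m∸n+n≡m N≤t+a)) (ℕₚ.+-mono-< t<N a<N))
    wrapped≡a : t ℕ.+ a ℕ.∸ N ≡ a
    wrapped≡a = trans (sym (m<n⇒m%n≡m wrapped<N)) (trans (m≤n⇒[n∸m]%m≡n%m N≤t+a) fixed)
    t≡N : t ≡ N
    t≡N = ℕₚ.+-cancelʳ-≡ a t N (trans (sym (ℕₚ.m∸n+n≡m N≤t+a))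
            (trans (cong (ℕ._+ N) wrapped≡a) (ℕₚ.+-comm a N)))

  [m%N+n]%N≡[m+n]%N : ∀ m n → (m % N ℕ.+ n) % N ≡ (m ℕ.+ n) % N
  [m%N+n]%N≡[m+n]%N m n = begin
    (m % N ℕ.+ n) % N               ≡⟨ %-distribˡ-+ (m % N) n N ⟩
    (m % N % N ℕ.+ n % N) % N       ≡⟨ cong (λ r → (r ℕ.+ n % N) % N) (m%n%n≡m%n m N) ⟩
    (m % N ℕ.+ n % N) % N           ≡⟨ %-distribˡ-+ m n N ⟨
    (m ℕ.+ n) % N                   ∎

  difference : ℕ → ℕ → ℕ
  difference h g = (h ℕ.+ (N ℕ.∸ g)) % N

  difference<N : ∀ h g → difference h g ℕ.< N
  difference<N h g = m%n<n (h ℕ.+ (N ℕ.∸ g)) N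

  translate-difference : ∀ h g → h ℕ.< N → g ℕ.< N → (difference h g ℕ.+ g) % N ≡ h
  translate-difference h g h<N g<N = begin
    ((h ℕ.+ (N ℕ.∸ g)) % N ℕ.+ g) % N     ≡⟨ [m%N+n]%N≡[m+n]%N (h ℕ.+ (N ℕ.∸ g)) g ⟩
    (h ℕ.+ (N ℕ.∸ g) ℕ.+ g) % N           ≡⟨ cong (_% N) (trans (ℕₚ.+-assoc h (N ℕ.∸ g) g)
                                                             (cong (h ℕ.+_) (ℕₚ.m∸n+n≡m (ℕₚ.<⇒≤ g<N)))) ⟩
    (h ℕ.+ N) % N                         ≡⟨ [m+n]%n≡m%n h N ⟩
    h % N                                 ≡⟨ m<n⇒m%n≡m h<N ⟩
    h                                     ∎

module CayleyGraph (k : ℕ) where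

  n N : ℕ
  n = suc k
  N = 2 ℕ.* n

  open Translation N
  open Cayley (≡-dec Finₚ._≟_ Finₚ._≟_) (_·_ n) (S n)

  toℕ-mod : ∀ t → toℕ (t mod N) ≡ t % N
  toℕ-mod t = Finₚ.toℕ-fromℕ< (m%n<n t N)

  toℕ-mod-< : ∀ t → t ℕ.< N → toℕ (t mod N) ≡ t
  toℕ-mod-< t t<N = trans (toℕ-mod t) (m<n⇒m%n≡m t<N)

  toℕ-proj₁-· : ∀ s g → toℕ (proj₁ (_·_ n s g)) ≡ (toℕ (proj₁ s) ℕ.+ toℕ (proj₁ g)) % N
  toℕ-proj₁-· s g = toℕ-mod (toℕ (proj₁ s) ℕ.+ toℕ (proj₁ g))

  evenGenerators oddGenerators : ℕ → List (U n)
  evenGenerators r = map (ab n (2 ℕ.* r)) (upTo 3)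
  oddGenerators h = map (ab n (suc (2 ℕ.* h))) (upTo 3)

  ab∈S : ∀ t j → 0 ℕ.< t → t ℕ.< N → j ℕ.< 3 → ab n t j ∈ S n
  ab∈S t j 0<t t<N j<3 with t % 2 | m%n<n t 2 | m≡m%n+[m/n]*n t 2
  ... | suc (suc _) | ℕ.s≤s (ℕ.s≤s ()) | _
  ... | zero        | _ | t≡ with t / 2
  ...   | zero   = ⊥-elim (ℕₚ.<-irrefl (sym t≡) 0<t)
  ...   | suc r = subst (λ t → ab n t j ∈ S n) (sym t≡2r) (∈-++⁺ˡ (∈-concatMap⁺ evenGenerators
                    (lose (∈-map⁺ suc (∈-upTo⁺ r<k)) (∈-map⁺ (ab n (2 ℕ.* suc r)) (∈-upTo⁺ j<3)))))
    where
    t≡2r : t ≡ 2 ℕ.* suc r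
    t≡2r = trans t≡ (ℕₚ.*-comm (suc r) 2)
    r<k : r ℕ.< k
    r<k = ℕₚ.≤-pred (ℕₚ.*-cancelˡ-< 2 (suc r) n (subst (ℕ._< N) t≡2r t<N))
  ab∈S t j 0<t t<N j<3 | suc zero | _ | t≡ =
    subst (λ t → ab n t j ∈ S n) (sym t≡2h+1) (∈-++⁺ʳ (S₁ n) (∈-concatMap⁺ oddGenerators
      (lose (∈-upTo⁺ h<n) (∈-map⁺ (ab n (suc (2 ℕ.* (t / 2)))) (∈-upTo⁺ j<3)))))
    where
    t≡2h+1 : t ≡ suc (2 ℕ.* (t / 2))
    t≡2h+1 = trans t≡ (cong suc (ℕₚ.*-comm (t / 2) 2))
    h<n : t / 2 ℕ.< n
    h<n = ℕₚ.*-cancelˡ-< 2 (t / 2) n (ℕₚ.<-trans (ℕₚ.n<1+n _) (subst (ℕ._< N) t≡2h+1 t<N))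

  ∈S⇒ab : ∀ s → s ∈ S n → ∃ λ t → ∃ λ j → (0 ℕ.< t) × (t ℕ.< N) × (s ≡ ab n t j)
  ∈S⇒ab s s∈S with ∈-++⁻ (S₁ n) s∈S
  ... | inj₁ s∈S₁ with find (∈-concatMap⁻ evenGenerators {map suc (upTo k)} s∈S₁)
  ...   | r , r∈ , s∈ with ∈-map⁻ suc r∈ | ∈-map⁻ (ab n (2 ℕ.* r)) {xs = upTo 3} s∈
  ...     | r₀ , r₀∈ , refl | j , _ , s≡ =
    2 ℕ.* suc r₀ , j , ℕₚ.*-monoʳ-< 2 (ℕ.s≤s ℕ.z≤n) , ℕₚ.*-monoʳ-< 2 (ℕ.s≤s (∈-upTo⁻ r₀∈)) , s≡
  ∈S⇒ab s s∈S | inj₂ s∈S₂ with find (∈-concatMap⁻ oddGenerators {upTo n} s∈S₂)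
  ...   | h , h∈ , s∈ with ∈-map⁻ (ab n (suc (2 ℕ.* h))) {xs = upTo 3} s∈
  ...     | j , _ , s≡ =
    suc (2 ℕ.* h) , j , ℕ.s≤s ℕ.z≤n ,
    ℕₚ.<-≤-trans (ℕₚ.n<1+n _) (subst (ℕ._≤ N) (ℕₚ.*-suc 2 h) (ℕₚ.*-monoʳ-≤ 2 (∈-upTo⁻ h∈))) , s≡

  ∈S⇒a≢0 : ∀ s → s ∈ S n → toℕ (proj₁ s) ≢ 0
  ∈S⇒a≢0 s s∈S with ∈S⇒ab s s∈S
  ... | t , j , 0<t , t<N , refl = λ t≡0 → ℕₚ.<-irrefl (sym (trans (sym (toℕ-mod-< t t<N)) t≡0)) 0<t

  -- The solution l of ±l + j ≡ j′ (mod 3), with sign + iff e; as in `twist`, −1 is represented by 2.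
  bExponent : Bool → Fin 3 → Fin 3 → ℕ
  bExponent true  j j′ = (toℕ j′ ℕ.+ 3 ℕ.∸ toℕ j) % 3
  bExponent false j j′ = (2 ℕ.* (toℕ j′ ℕ.+ 3 ℕ.∸ toℕ j)) % 3

  bExponent<3 : ∀ e j j′ → bExponent e j j′ ℕ.< 3
  bExponent<3 true  j j′ = m%n<n (toℕ j′ ℕ.+ 3 ℕ.∸ toℕ j) 3
  bExponent<3 false j j′ = m%n<n (2 ℕ.* (toℕ j′ ℕ.+ 3 ℕ.∸ toℕ j)) 3

  bExponent-solves : ∀ e j j′ →
    ((if e then toℕ (bExponent e j j′ mod 3) else 2 ℕ.* toℕ (bExponent e j j′ mod 3)) ℕ.+ toℕ j) mod 3 ≡ j′
  bExponent-solves true  0F 0F = refl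
  bExponent-solves true  0F 1F = refl
  bExponent-solves true  0F 2F = refl
  bExponent-solves true  1F 0F = refl
  bExponent-solves true  1F 1F = refl
  bExponent-solves true  1F 2F = refl
  bExponent-solves true  2F 0F = refl
  bExponent-solves true  2F 1F = refl
  bExponent-solves true  2F 2F = refl
  bExponent-solves false 0F 0F = refl
  bExponent-solves false 0F 1F = refl
  bExponent-solves false 0F 2F = refl
  bExponent-solves false 1F 0F = refl
  bExponent-solves false 1F 1F = refl
  bExponent-solves false 1F 2F = refl
  bExponent-solves false 2F 0F = refl
  bExponent-solves false 2F 1F = refl
  bExponent-solves false 2F 2F = refl

  -- h = s g for s = a^t b^l with t ≡ a(h) − a(g) (mod 2n) and l given by bExponent.
  adjacent : ∀ g h → proj₁ g ≢ proj₁ h → Adj g h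
  adjacent (i , j) (i′ , j′) i≢i′ = ab n t l , ab∈S t l 0<t t<N (bExponent<3 e j j′) , cong₂ _,_ a-parts (sym (bExponent-solves e j j′))
    where
    t = difference (toℕ i′) (toℕ i)
    t<N = difference<N (toℕ i′) (toℕ i)
    translates : (t ℕ.+ toℕ i) % N ≡ toℕ i′
    translates = translate-difference (toℕ i′) (toℕ i) (Finₚ.toℕ<n i′) (Finₚ.toℕ<n i)
    0<t : 0 ℕ.< t
    0<t = ℕₚ.n≢0⇒n>0 (λ t≡0 → i≢i′ (Finₚ.toℕ-injective
            (trans (sym (m<n⇒m%n≡m (Finₚ.toℕ<n i))) (trans (cong (λ u → (u ℕ.+ toℕ i) % N) (sym t≡0)) translates))))
    e = does (toℕ i % 2 ℕ.≟ 0)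
    l = bExponent e j j′
    a-parts : i′ ≡ (toℕ (t mod N) ℕ.+ toℕ i) mod N
    a-parts = Finₚ.toℕ-injective (sym (trans (toℕ-mod (toℕ (t mod N) ℕ.+ toℕ i))
                (trans (cong (λ u → (u ℕ.+ toℕ i) % N) (toℕ-mod-< t t<N)) translates)))

  not-adjacent : ∀ g h → proj₁ g ≡ proj₁ h → ∀ s → s ∈ S n → h ≢ _·_ n s g
  not-adjacent g h g≡h s s∈S h≡sg = ∈S⇒a≢0 s s∈S (translate-fixed⇒0 (toℕ (proj₁ s)) (toℕ (proj₁ g))
    (Finₚ.toℕ<n (proj₁ s)) (Finₚ.toℕ<n (proj₁ g))
    (trans (sym (toℕ-proj₁-· s g)) (cong (toℕ ∘ proj₁) (trans (sym h≡sg) (cong₂ _,_ (sym g≡h) refl)))))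

  adj≡1-δ : ∀ g h → adj g h ≡ + 1 ℤ.- δ (proj₁ g) (proj₁ h)
  adj≡1-δ g h with proj₁ g Finₚ.≟ proj₁ h
  ... | no g≢h  = cong (λ b → if b then + 1 else + 0) (dec-true (any? (λ s → h ≟U _·_ n s g) (S n))
                    (lose (proj₁ (proj₂ (adjacent g h g≢h))) (proj₂ (proj₂ (adjacent g h g≢h)))))
    where _≟U_ = ≡-dec Finₚ._≟_ Finₚ._≟_
  ... | yes g≡h = cong (λ b → if b then + 1 else + 0) (dec-false (any? (λ s → h ≟U _·_ n s g) (S n))
                    λ h∈Sg → let s , s∈S , h≡sg = find h∈Sg in not-adjacent g h g≡h s s∈S h≡sg)
    where _≟U_ = ≡-dec Finₚ._≟_ Finₚ._≟_

  1<N : 1 ℕ.< N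
  1<N = ℕₚ.*-monoʳ-≤ 2 (ℕ.s≤s (ℕ.z≤n {k}))

  otherBlock : Fin N → Fin N
  otherBlock fzero    = Fin.fromℕ< 1<N
  otherBlock (fsuc _) = fzero

  otherBlock≢ : ∀ q → otherBlock q ≢ q
  otherBlock≢ fzero    eq = ℕₚ.1+n≢0 (trans (sym (Finₚ.toℕ-fromℕ< 1<N)) (cong toℕ eq))
  otherBlock≢ (fsuc _) ()

  connected : Connected
  connected g h with proj₁ g Finₚ.≟ proj₁ h
  ... | no g≢h  = step here (adjacent g h g≢h)
  ... | yes g≡h = step (step here (adjacent g w (otherBlock≢ (proj₁ g) ∘ sym)))
                       (adjacent w h (λ w≡h → otherBlock≢ (proj₁ g) (trans w≡h (sym g≡h))))
    where
    w : U n
    w = otherBlock (proj₁ g) , 0F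

-- The spectrum

if-≟≡*δ : ∀ {m} (x : ℤ) (i j : Fin m) → (if does (i Finₚ.≟ j) then x else + 0) ≡ x * δ i j
if-≟≡*δ x i j with i Finₚ.≟ j
... | yes _ = sym (ℤₚ.*-identityʳ x)
... | no _  = sym (ℤₚ.*-zeroʳ x)

[x*x]^b*[x*x]≡x^[2b+2] : ∀ (x : ℤ) b → (x * x) ^ b * (x * x) ≡ x ^ (2 ℕ.* b ℕ.+ 2)
[x*x]^b*[x*x]≡x^[2b+2] x b = begin
  (x * x) ^ b * (x * x)       ≡⟨ cong (λ y → y ^ b * y) (cong (x *_) (sym (ℤₚ.*-identityʳ x))) ⟩
  (x ^ 2) ^ b * x ^ 2         ≡⟨ cong (_* x ^ 2) (ℤₚ.^-*-assoc x 2 b) ⟩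
  x ^ (2 ℕ.* b) * x ^ 2       ≡⟨ ℤₚ.^-distribˡ-+-* x (2 ℕ.* b) 2 ⟨
  x ^ (2 ℕ.* b ℕ.+ 2)         ∎

module Spectrum (k : ℕ) where

  n b m : ℕ
  n = suc k
  b = 2 ℕ.* n ℕ.∸ 1
  m = (2 ℕ.* n) ℕ.* 3

  open BlockElimination b using (flatten; charMatrix; δ-block-slot; det-charMatrix)
  open CayleyGraph k using (adj≡1-δ)

  spectrum : List (ℤ × ℕ)
  spectrum = (- + 3 , 2 ℕ.* n ℕ.∸ 1) ∷ (+ 0 , 4 ℕ.* n) ∷ (+ (6 ℕ.* n ℕ.∸ 3) , 1) ∷ []

  charPoly≡det : ∀ x → charPoly m (A n) x ≡ det m (flatten x (charMatrix x))
  charPoly≡det x = det-cong m λ i j →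
    cong₂ _-_ (trans (if-≟≡*δ x i j) (cong (x *_) (δ-block-slot x i j))) (adj≡1-δ (Fin.remQuot 3 i) (Fin.remQuot 3 j))

  4n≡2b+2 : 4 ℕ.* n ≡ 2 ℕ.* b ℕ.+ 2
  4n≡2b+2 = solve k
    where
    solve : ∀ k → 4 ℕ.* suc k ≡ 2 ℕ.* (k ℕ.+ suc (k ℕ.+ 0)) ℕ.+ 2
    solve = ℕ-Solver.solve-∀

  6n∸3≡3b : 6 ℕ.* n ℕ.∸ 3 ≡ 3 ℕ.* b
  6n∸3≡3b = trans (cong (ℕ._∸ 3) (solve k)) (ℕₚ.m+n∸m≡n 3 (3 ℕ.* b))
    where
    solve : ∀ k → 6 ℕ.* suc k ≡ 3 ℕ.+ 3 ℕ.* (k ℕ.+ suc (k ℕ.+ 0))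
    solve = ℕ-Solver.solve-∀

  charPoly≡spectrum : ∀ x → charPoly m (A n) x ≡ prodSpec spectrum x
  charPoly≡spectrum x = begin
    charPoly m (A n) x
      ≡⟨ charPoly≡det x ⟩
    det m (flatten x (charMatrix x))
      ≡⟨ det-charMatrix x ⟩
    (x - + 3 * + b) * (((x * x) ^ b * x) * ((x + + 3) ^ b * x))
      ≡⟨ rearrange (x - + 3 * + b) x ((x * x) ^ b) ((x + + 3) ^ b) ⟩
    (x + + 3) ^ b * (((x * x) ^ b * (x * x)) * ((x - + 3 * + b) * + 1 * + 1))
      ≡⟨ cong₂ (λ p e → (x + + 3) ^ b * (p * ((x - e) * + 1 * + 1)))
               (trans ([x*x]^b*[x*x]≡x^[2b+2] x b) (sym (trans (cong (_^ (4 ℕ.* n)) (ℤₚ.+-identityʳ x)) (cong (x ^_) 4n≡2b+2))))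
               (trans (sym (ℤₚ.pos-* 3 b)) (cong +_ (sym 6n∸3≡3b))) ⟩
    prodSpec spectrum x ∎
    where
    rearrange : ∀ y x P Q → y * ((P * x) * (Q * x)) ≡ Q * ((P * (x * x)) * (y * + 1 * + 1))
    rearrange = solve-∀

corollary7 : (n : ℕ) .{{_ : NonZero n}} → 1 ℕ.< n →
    CayConnected n
    × Integral ((2 ℕ.* n) ℕ.* 3) (A n)
    × HasSpectrum ((2 ℕ.* n) ℕ.* 3) (A n)
        ((- + 3 , 2 ℕ.* n ℕ.∸ 1) ∷ (+ 0 , 4 ℕ.* n) ∷ (+ (6 ℕ.* n ℕ.∸ 3) , 1) ∷ [])
corollary7 (suc k) _ = CayleyGraph.connected k , (spectrum , charPoly≡spectrum) , charPoly≡spectrum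
  where open Spectrum k
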